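{- A plane belonging to the $K$-orbit $\Sigma_6$ has point-orbit distribution $[1,(q+1)/2,(q+1)/2,q^2-1]$. Its points of rank $2$ lie on a line of type $o_{10}$.
   Context: $q$ is odd; $\varepsilon$ is a non-square in $\mathbb{F}_q$. Points of $\mathrm{PG}(5,q)$ are represented by symmetric $3\times3$ matrices over $\mathbb{F}_q$ (up to scalars), with rank equal to the matrix rank; rank-1 points form the quadric Veronesean $\mathcal{V}(\mathbb{F}_q)$. $K=\mathrm{PGL}(3,q)$ acts via $M\mapsto AMA^T$. Each rank-2 point $z$ lies in the plane of a unique conic $\mathcal{C}_z\subset\mathcal{V}(\mathbb{F}_q)$; $z$ is exterior ($\mathcal{P}_{2,e}$) if it lies on a tangent to $\mathcal{C}_z$ and interior ($\mathcal{P}_{2,i}$) otherwise. The point-orbit distribution is $[n_1,n_2,n_3,n_4]$ = numbers of points of rank 1, of $\mathcal{P}_{2,e}$, of $\mathcal{P}_{2,i}$, of rank 3. $\Sigma_6$ is the $K$-orbit of the plane $\{\begin{pmatrix}\alpha&\beta&0\\ \beta&\varepsilon\alpha&0\\ 0&0&\gamma\end{pmatrix}\}$, $(\alpha,\beta,\gamma)\neq0$. A line of type $o_{10}$ is a line in the $K$-orbit of $\{\begin{pmatrix}v\alpha&\beta&0\\ \beta&\alpha+u\beta&0\\0&0&0\end{pmatrix}\}$ where $v\lambda^2+uv\lambda-1\neq0$ for all $\lambda\in\mathbb{F}_q$ (point-orbit distribution $[0,(q+1)/2,(q+1)/2,0]$). -}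

module Defs where

open import Level using (0ℓ) renaming (suc to lsuc)
open import Algebra.Bundles using (CommutativeRing)
open import Data.Nat as ℕ using (ℕ)
open import Data.Fin using (Fin; zero; suc)
open import Data.List using (List; length)
open import Data.List.Relation.Unary.All using (All)
open import Data.List.Relation.Unary.Any using (Any)
open import Data.List.Relation.Unary.AllPairs using (AllPairs)
open import Data.Product using (Σ; ∃; ∃-syntax; _×_; _,_)
open import Data.Sum using (_⊎_)
open import Relation.Nullary using (¬_)
open import Relation.Binary using (Decidable)

record FiniteField : Set₁ where
  field
    commRing : CommutativeRing 0ℓ 0ℓ
  open CommutativeRing commRing public hiding (zero)
  field
    0≉1      : ¬ (0# ≈ 1#)
    inverse  : ∀ x → ¬ (x ≈ 0#) → ∃[ y ] (x * y ≈ 1#)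
    _≟_      : Decidable _≈_
    elems    : List Carrier
    complete : ∀ x → Any (x ≈_) elems
    distinct : AllPairs (λ a b → ¬ (a ≈ b)) elems

  order : ℕ
  order = length elems

module Geometry (F : FiniteField) where
  open FiniteField F

  Mat : Set
  Mat = Fin 3 → Fin 3 → Carrier

  sum3 : (Fin 3 → Carrier) → Carrier
  sum3 f = f zero + (f (suc zero) + f (suc (suc zero)))

  _⊗_ : Mat → Mat → Mat
  (A ⊗ B) i j = sum3 (λ k → A i k * B k j)

  tr : Mat → Mat
  tr A i j = A j i

  -- the action M ↦ A M Aᵀ of GL(3,q) (PGL(3,q) acts through it)
  act : Mat → Mat → Mat
  act A M = (A ⊗ M) ⊗ tr A

  scale : Carrier → Mat → Mat
  scale c M i j = c * M i j

  _≋_ : Mat → Mat → Set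
  M ≋ N = ∀ i j → M i j ≈ N i j

  Symmetric : Mat → Set
  Symmetric M = ∀ i j → M i j ≈ M j i

  -- M and N represent the same projective point
  Proportional : Mat → Mat → Set
  Proportional M N = ∃[ c ] (¬ (c ≈ 0#) × (M ≋ scale c N))

  minor : Mat → Fin 3 → Fin 3 → Fin 3 → Fin 3 → Carrier
  minor M i i' j j' = M i j * M i' j' - M i j' * M i' j

  f0 f1 f2 : Fin 3
  f0 = zero
  f1 = suc zero
  f2 = suc (suc zero)

  det : Mat → Carrier
  det M = M f0 f0 * minor M f1 f2 f1 f2
        - M f0 f1 * minor M f1 f2 f0 f2
        + M f0 f2 * minor M f1 f2 f0 f1

  AllZero : Mat → Set
  AllZero M = ∀ i j → M i j ≈ 0#

  AllMinorsZero : Mat → Set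
  AllMinorsZero M = ∀ i i' j j' → minor M i i' j j' ≈ 0#

  Rank1 Rank2 Rank3 : Mat → Set
  Rank1 M = ¬ AllZero M × AllMinorsZero M
  Rank2 M = ¬ AllMinorsZero M × det M ≈ 0#
  Rank3 M = ¬ (det M ≈ 0#)

  Invertible : Mat → Set
  Invertible A = ¬ (det A ≈ 0#)

  Vec3 : Set
  Vec3 = Fin 3 → Carrier

  NonzeroVec : Vec3 → Set
  NonzeroVec x = ¬ (∀ i → x i ≈ 0#)

  -- x xᵀ : the Veronese image of the point ⟨x⟩ of PG(2,q)
  outer : Vec3 → Mat
  outer x i j = x i * x j

  _+M_ : Mat → Mat → Mat
  (M +M N) i j = M i j + N i j

  -- A rank-2 point z lies in the plane of the conic C_z = {x xᵀ : ⟨x⟩ ⊆ col(z)}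
  -- (that plane consists of the symmetric matrices with column space in
  -- col(z)).  The points x xᵀ of C_z are those with x = z w, x ≠ 0.
  -- A tangent line to C_z at x xᵀ is a line of the plane of C_z through
  -- x xᵀ meeting C_z only in x xᵀ.  z is exterior iff it lies on such a
  -- tangent: the line ⟨z, x xᵀ⟩ (points z + t x xᵀ and x xᵀ) contains no
  -- rank-1 point other than x xᵀ.
  OnConicOf : Mat → Vec3 → Set
  OnConicOf z x = NonzeroVec x × Σ Vec3 λ w → (∀ i → x i ≈ sum3 (λ k → z i k * w k))

  Exterior : Mat → Set
  Exterior z = Rank2 z × Σ Vec3 λ x → (OnConicOf z x × (∀ t → ¬ Rank1 (z +M scale t (outer x))))

  Interior : Mat → Set
  Interior z = Rank2 z × ¬ Exterior z

  sigma6Mat : Carrier → Carrier → Carrier → Carrier → Mat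
  sigma6Mat ε α β γ zero zero = α
  sigma6Mat ε α β γ zero (suc zero) = β
  sigma6Mat ε α β γ (suc zero) zero = β
  sigma6Mat ε α β γ (suc zero) (suc zero) = ε * α
  sigma6Mat ε α β γ (suc (suc zero)) (suc (suc zero)) = γ
  sigma6Mat ε α β γ _ _ = 0#

  InSigma6Plane : Carrier → Mat → Mat → Set
  InSigma6Plane ε A Z = ∃[ α ] ∃[ β ] ∃[ γ ] (Z ≋ act A (sigma6Mat ε α β γ))

  o10Mat : Carrier → Carrier → Carrier → Carrier → Mat
  o10Mat u v α β zero zero = v * α
  o10Mat u v α β zero (suc zero) = β
  o10Mat u v α β (suc zero) zero = β
  o10Mat u v α β (suc zero) (suc zero) = α + u * β
  o10Mat u v α β _ _ = 0#

  O10Params : Carrier → Carrier → Set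
  O10Params u v = ∀ λ' → ¬ (v * (λ' * λ') + u * v * λ' - 1# ≈ 0#)

  InO10Line : Carrier → Carrier → Mat → Mat → Set
  InO10Line u v B Z = ∃[ α ] ∃[ β ] (Z ≋ act B (o10Mat u v α β))

  -- The number of points of PG(5,q) satisfying P (P is assumed to be a
  -- property of nonzero matrices) is n: there is a list of n pairwise
  -- non-proportional matrices satisfying P, and every matrix satisfying P
  -- is proportional to one in the list.
  NumPoints : (Mat → Set) → ℕ → Set
  NumPoints P n = Σ (List Mat) λ L → (length L ≡ n × All P L
                     × AllPairs (λ M N → ¬ Proportional M N) L
                     × (∀ Z → P Z → Any (Proportional Z) L))
    where open import Relation.Binary.PropositionalEquality using (_≡_)

module Submission where

-- Rank, exterior/interior type and proportionality are invariant under
-- M ↦ C M Cᵀ (C inverted up to a scalar by its adjugate) and rescaling, so we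
-- count on Π.  There det σ(α,β,γ) = γ·(εα² − β²) with εα² − β² anisotropic:
-- one rank-1 point σ(0,0,1), q² − 1 rank-3 points σ(α,β,1), and rank-2 points
-- σ(α,β,0) indexed by the projective line.  σ(α,β,0) is exterior iff the form
-- Q_{α,β}(x) = εα x₁² + α x₂² − 2β x₁x₂ is isotropic, i.e. iff (α:β) = ν(x) for
-- a 2-to-1 map ν of the projective line; so half of the q + 1 points are
-- exterior.  The line γ = 0 is the o₁₀ line u = 0, v = ε⁻¹.
-- Sections: integer ring solver; field and matrix algebra; invariance;
-- counting by representatives; Π; exterior criterion; ν; counts; theorem.

open import Level using (0ℓ)
open import Algebra.Bundles using (CommutativeRing)
import Algebra.Solver.Ring.AlmostCommutativeRing as ACR
open import Data.Empty using (⊥-elim)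
open import Data.Fin using (Fin; zero; suc; #_)
open import Data.Integer as ℤ using (ℤ; +_; -[1+_]; _⊖_; _◃_; sign; ∣_∣)
import Data.Integer.Properties as ℤP
open import Data.List using (List; []; _∷_; length; map; filter; cartesianProduct)
import Data.List.Properties as ListP
open import Data.List.Relation.Unary.All as All using (All; []; _∷_)
import Data.List.Relation.Unary.All.Properties as AllP
open import Data.List.Relation.Unary.AllPairs as AllPairs using (AllPairs; []; _∷_)
import Data.List.Relation.Unary.AllPairs.Properties as AllPairsP
open import Data.List.Relation.Unary.Any as Any using (Any; here; there)
import Data.List.Relation.Unary.Any.Properties as AnyP
import Data.List.Relation.Unary.Unique.Setoid.Properties as UniqueP
open import Data.Maybe using (Maybe; just; nothing)
open import Data.Nat as ℕ using (ℕ; zero; suc; _≤_; z≤n; s≤s)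
open import Data.Nat.DivMod using (_/_; m*n/n≡m)
open import Data.Nat.Divisibility using (_∣_)
import Data.Nat.Properties as ℕP
open import Data.Product using (Σ; _×_; _,_; proj₁; proj₂)
open import Data.Product.Relation.Binary.Pointwise.NonDependent using (Pointwise)
open import Data.Sign as Sign using (Sign)
open import Data.Sum using (_⊎_; inj₁; inj₂; [_,_]′)
open import Data.Vec using (Vec; []; _∷_)
open import Relation.Binary.Bundles using (Setoid)
open import Relation.Binary.PropositionalEquality as ≡ using (_≡_)
import Relation.Binary.Reasoning.Setoid as SetoidReasoning
open import Relation.Nullary using (¬_; Dec; yes; no; _×-dec_)
open import Relation.Nullary.Decidable using (¬?)
open import Relation.Unary using (Decidable)
open import Relation.Unary.Properties using (∁?)

open import Defs

-- The ring solver for an arbitrary commutative ring R, with integer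
-- coefficients interpreted through the canonical map ℤ → R.  The map
-- sends 0 and 1 to 0# and 1# definitionally, so solver goals mentioning
-- the constants 0 and 1 match the ring's own constants.
module IntegerSolver (R : CommutativeRing 0ℓ 0ℓ) where
  open CommutativeRing R
  open import Relation.Binary.Reasoning.Setoid setoid
  open import Algebra.Properties.Ring ring using (-0#≈0#; -‿involutive; -‿+-comm; -1*x≈-x)
  open import Algebra.Properties.CommutativeSemigroup *-commutativeSemigroup using (interchange)
  open import Algebra.Properties.Semiring.Mult.TCOptimised semiring using (×-homo-+; ×1-homo-*) renaming (_×_ to _×ℕ_)

  ⟦_⟧ℕ : ℕ → Carrier
  ⟦ n ⟧ℕ = n ×ℕ 1#

  ⟦_⟧ℤ : ℤ → Carrier
  ⟦ + n ⟧ℤ = ⟦ n ⟧ℕ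
  ⟦ -[1+ n ] ⟧ℤ = - ⟦ suc n ⟧ℕ

  ⟦suc⟧ : ∀ n → ⟦ suc n ⟧ℕ ≈ 1# + ⟦ n ⟧ℕ
  ⟦suc⟧ n = ×-homo-+ 1# 1 n

  ⊖-hom : ∀ m n → ⟦ m ⊖ n ⟧ℤ ≈ ⟦ m ⟧ℕ - ⟦ n ⟧ℕ
  ⊖-hom zero zero = sym (-‿inverseʳ 0#)
  ⊖-hom zero (suc n) = sym (+-identityˡ _)
  ⊖-hom (suc m) zero = sym (trans (+-congˡ -0#≈0#) (+-identityʳ _))
  ⊖-hom (suc m) (suc n) = begin
    ⟦ suc m ⊖ suc n ⟧ℤ                  ≡⟨ ≡.cong ⟦_⟧ℤ (ℤP.[1+m]⊖[1+n]≡m⊖n m n) ⟩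
    ⟦ m ⊖ n ⟧ℤ                          ≈⟨ ⊖-hom m n ⟩
    ⟦ m ⟧ℕ - ⟦ n ⟧ℕ                     ≈⟨ sym (cancel-1 ⟦ m ⟧ℕ ⟦ n ⟧ℕ) ⟩
    (1# + ⟦ m ⟧ℕ) - (1# + ⟦ n ⟧ℕ)       ≈⟨ sym (+-cong (⟦suc⟧ m) (-‿cong (⟦suc⟧ n))) ⟩
    ⟦ suc m ⟧ℕ - ⟦ suc n ⟧ℕ             ∎
    where
    cancel-1 : ∀ a b → (1# + a) - (1# + b) ≈ a - b
    cancel-1 a b = begin
      (1# + a) + - (1# + b)     ≈⟨ +-congˡ (sym (-‿+-comm 1# b)) ⟩
      (1# + a) + (- 1# + - b)   ≈⟨ +-assoc _ _ _ ⟩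
      1# + (a + (- 1# + - b))   ≈⟨ +-congˡ (trans (sym (+-assoc _ _ _)) (trans (+-congʳ (+-comm _ _)) (+-assoc _ _ _))) ⟩
      1# + (- 1# + (a + - b))   ≈⟨ sym (+-assoc _ _ _) ⟩
      (1# + - 1#) + (a + - b)   ≈⟨ trans (+-congʳ (-‿inverseʳ 1#)) (+-identityˡ _) ⟩
      a - b                     ∎

  neg-hom : ∀ i → ⟦ ℤ.- i ⟧ℤ ≈ - ⟦ i ⟧ℤ
  neg-hom -[1+ n ] = sym (-‿involutive _)
  neg-hom (+ zero) = sym -0#≈0#
  neg-hom (+ suc n) = refl

  add-hom : ∀ i j → ⟦ i ℤ.+ j ⟧ℤ ≈ ⟦ i ⟧ℤ + ⟦ j ⟧ℤ
  add-hom -[1+ m ] -[1+ n ] = begin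
    - ⟦ suc (suc (m ℕ.+ n)) ⟧ℕ          ≡⟨ ≡.cong (λ k → - ⟦ suc k ⟧ℕ) (≡.sym (ℕP.+-suc m n)) ⟩
    - ⟦ suc m ℕ.+ suc n ⟧ℕ              ≈⟨ -‿cong (×-homo-+ 1# (suc m) (suc n)) ⟩
    - (⟦ suc m ⟧ℕ + ⟦ suc n ⟧ℕ)         ≈⟨ sym (-‿+-comm _ _) ⟩
    - ⟦ suc m ⟧ℕ + - ⟦ suc n ⟧ℕ         ∎
  add-hom -[1+ m ] (+ n) = trans (⊖-hom n (suc m)) (+-comm _ _)
  add-hom (+ m) -[1+ n ] = ⊖-hom m (suc n)
  add-hom (+ m) (+ n) = ×-homo-+ 1# m n

  ⟦_⟧± : Sign → Carrier
  ⟦ Sign.+ ⟧± = 1#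
  ⟦ Sign.- ⟧± = - 1#

  ◃-hom : ∀ s n → ⟦ s ◃ n ⟧ℤ ≈ ⟦ s ⟧± * ⟦ n ⟧ℕ
  ◃-hom s zero = sym (zeroʳ _)
  ◃-hom Sign.+ (suc n) = sym (*-identityˡ _)
  ◃-hom Sign.- (suc n) = sym (-1*x≈-x _)

  sign-hom : ∀ s t → ⟦ s Sign.* t ⟧± ≈ ⟦ s ⟧± * ⟦ t ⟧±
  sign-hom Sign.- Sign.- = sym (trans (-1*x≈-x (- 1#)) (-‿involutive 1#))
  sign-hom Sign.- Sign.+ = sym (*-identityʳ _)
  sign-hom Sign.+ Sign.- = sym (*-identityˡ _)
  sign-hom Sign.+ Sign.+ = sym (*-identityˡ _)

  mul-hom : ∀ i j → ⟦ i ℤ.* j ⟧ℤ ≈ ⟦ i ⟧ℤ * ⟦ j ⟧ℤ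
  mul-hom i j = begin
    ⟦ (sign i Sign.* sign j) ◃ (∣ i ∣ ℕ.* ∣ j ∣) ⟧ℤ             ≈⟨ ◃-hom (sign i Sign.* sign j) (∣ i ∣ ℕ.* ∣ j ∣) ⟩
    ⟦ sign i Sign.* sign j ⟧± * ⟦ ∣ i ∣ ℕ.* ∣ j ∣ ⟧ℕ            ≈⟨ *-cong (sign-hom (sign i) (sign j)) (×1-homo-* ∣ i ∣ ∣ j ∣) ⟩
    (⟦ sign i ⟧± * ⟦ sign j ⟧±) * (⟦ ∣ i ∣ ⟧ℕ * ⟦ ∣ j ∣ ⟧ℕ)    ≈⟨ interchange _ _ _ _ ⟩
    (⟦ sign i ⟧± * ⟦ ∣ i ∣ ⟧ℕ) * (⟦ sign j ⟧± * ⟦ ∣ j ∣ ⟧ℕ)    ≈⟨ sym (*-cong (sign-abs i) (sign-abs j)) ⟩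
    ⟦ i ⟧ℤ * ⟦ j ⟧ℤ                                             ∎
    where
    sign-abs : ∀ k → ⟦ k ⟧ℤ ≈ ⟦ sign k ⟧± * ⟦ ∣ k ∣ ⟧ℕ
    sign-abs -[1+ n ] = ◃-hom Sign.- (suc n)
    sign-abs (+ zero) = sym (zeroʳ _)
    sign-abs (+ suc n) = sym (*-identityˡ _)

  ℤ⟶R : ℤ.+-*-rawRing ACR.-Raw-AlmostCommutative⟶ ACR.fromCommutativeRing R
  ℤ⟶R = record
    { ⟦_⟧ = ⟦_⟧ℤ ; +-homo = add-hom ; *-homo = mul-hom ; -‿homo = neg-hom
    ; 0-homo = refl ; 1-homo = refl }

  coeff-≟ : ∀ i j → Maybe (⟦ i ⟧ℤ ≈ ⟦ j ⟧ℤ)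
  coeff-≟ i j with i ℤ.≟ j
  ... | yes ≡.refl = just refl
  ... | no _ = nothing

  open import Algebra.Solver.Ring ℤ.+-*-rawRing (ACR.fromCommutativeRing R) ℤ⟶R coeff-≟ public


module FieldFacts (F : FiniteField) where
  open FiniteField F public
  open Geometry F public
  open IntegerSolver commRing public using (solve; prove; _:=_; _:+_; _:*_; _:-_; :-_; con; var; Polynomial)
  open import Algebra.Properties.Group +-group using (x∙y⁻¹≈ε⇒x≈y; x≈y⇒x∙y⁻¹≈ε)
  open SetoidReasoning setoid

  NZ : Carrier → Set
  NZ x = ¬ (x ≈ 0#)

  inv : (x : Carrier) → NZ x → Carrier
  inv x nz = proj₁ (inverse x nz)

  inv-r : ∀ x (nz : NZ x) → x * inv x nz ≈ 1#
  inv-r x nz = proj₂ (inverse x nz)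

  inv-l : ∀ x (nz : NZ x) → inv x nz * x ≈ 1#
  inv-l x nz = trans (*-comm _ _) (inv-r x nz)

  solve-for : ∀ c (nz : NZ c) {y z} → y ≈ c * z → z ≈ inv c nz * y
  solve-for c nz {y} {z} e = sym (begin
    inv c nz * y          ≈⟨ *-congˡ e ⟩
    inv c nz * (c * z)    ≈⟨ sym (*-assoc _ _ _) ⟩
    (inv c nz * c) * z    ≈⟨ *-congʳ (inv-l c nz) ⟩
    1# * z                ≈⟨ *-identityˡ z ⟩
    z                     ∎)

  cancel : ∀ {c x y} → NZ c → c * x ≈ c * y → x ≈ y
  cancel {c} nz eq = trans (solve-for c nz refl) (trans (*-congˡ eq) (sym (solve-for c nz refl)))

  cancel0 : ∀ {c x} → NZ c → c * x ≈ 0# → x ≈ 0#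
  cancel0 {c} nz eq = cancel nz (trans eq (sym (zeroʳ c)))

  zero-product : ∀ {x y} → x * y ≈ 0# → x ≈ 0# ⊎ y ≈ 0#
  zero-product {x} eq with x ≟ 0#
  ... | yes x≈0 = inj₁ x≈0
  ... | no x≉0 = inj₂ (cancel0 x≉0 eq)

  mulNZ : ∀ {x y} → NZ x → NZ y → NZ (x * y)
  mulNZ nx ny eq with zero-product eq
  ... | inj₁ x≈0 = nx x≈0
  ... | inj₂ y≈0 = ny y≈0

  square-zero : ∀ {x} → x * x ≈ 0# → x ≈ 0#
  square-zero eq with zero-product eq
  ... | inj₁ x≈0 = x≈0
  ... | inj₂ x≈0 = x≈0

  BothZero NotBothZero : Carrier → Carrier → Set
  BothZero a b = a ≈ 0# × b ≈ 0#
  NotBothZero a b = ¬ BothZero a b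

  notBothZero? : ∀ a b → Dec (NotBothZero a b)
  notBothZero? a b = ¬? ((a ≟ 0#) ×-dec (b ≟ 0#))

  1≉0 : NZ 1#
  1≉0 eq = 0≉1 (sym eq)

  inv-nz : ∀ x (nz : NZ x) → NZ (inv x nz)
  inv-nz x nz eq = 1≉0 (trans (sym (inv-r x nz)) (trans (*-congˡ eq) (zeroʳ x)))

  diff-zero : ∀ {x y} → x - y ≈ 0# → x ≈ y
  diff-zero = x∙y⁻¹≈ε⇒x≈y _ _

  zero-diff : ∀ {x y} → x ≈ y → x - y ≈ 0#
  zero-diff = x≈y⇒x∙y⁻¹≈ε

  search : {P : Carrier → Set} → (∀ {x y} → x ≈ y → P x → P y) → (∀ x → Dec (P x)) → Dec (Σ Carrier P)
  search resp P? with Any.any? P? elems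
  ... | yes found = yes (Any.satisfied found)
  ... | no none = no λ (x , px) → none (Any.map (λ x≈e → resp x≈e px) (complete x))

  ≋-refl : ∀ {M} → M ≋ M
  ≋-refl i j = refl

  ≋-sym : ∀ {M N} → M ≋ N → N ≋ M
  ≋-sym e i j = sym (e i j)

  ≋-trans : ∀ {M N O} → M ≋ N → N ≋ O → M ≋ O
  ≋-trans e f i j = trans (e i j) (f i j)

  MatSetoid : Setoid 0ℓ 0ℓ
  MatSetoid = record
    { Carrier = Mat ; _≈_ = _≋_
    ; isEquivalence = record { refl = ≋-refl ; sym = ≋-sym ; trans = ≋-trans } }

  module ≈-Reasoning = SetoidReasoning setoid
  module ≋-Reasoning = SetoidReasoning MatSetoid

  sum3-cong : ∀ {f g : Fin 3 → Carrier} → (∀ k → f k ≈ g k) → sum3 f ≈ sum3 g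
  sum3-cong e = +-cong (e f0) (+-cong (e f1) (e f2))

  ⊗-cong : ∀ {A A' B B'} → A ≋ A' → B ≋ B' → (A ⊗ B) ≋ (A' ⊗ B')
  ⊗-cong e f i j = sum3-cong (λ k → *-cong (e i k) (f k j))

  tr-cong : ∀ {A A'} → A ≋ A' → tr A ≋ tr A'
  tr-cong e i j = e j i

  act-cong : ∀ {C C' N N'} → C ≋ C' → N ≋ N' → act C N ≋ act C' N'
  act-cong e f = ⊗-cong (⊗-cong e f) (tr-cong e)

  scale-cong : ∀ {c c' N N'} → c ≈ c' → N ≋ N' → scale c N ≋ scale c' N'
  scale-cong e f i j = *-cong e (f i j)

  +M-cong : ∀ {M M' N N'} → M ≋ M' → N ≋ N' → (M +M N) ≋ (M' +M N')
  +M-cong e f i j = +-cong (e i j) (f i j)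

  minor-cong : ∀ {M N} → M ≋ N → ∀ i i' j j' → minor M i i' j j' ≈ minor N i i' j j'
  minor-cong e i i' j j' = +-cong (*-cong (e i j) (e i' j')) (-‿cong (*-cong (e i j') (e i' j)))

  det-cong : ∀ {M N} → M ≋ N → det M ≈ det N
  det-cong e = +-cong (+-cong (*-cong (e f0 f0) (minor-cong e f1 f2 f1 f2))
                              (-‿cong (*-cong (e f0 f1) (minor-cong e f1 f2 f0 f2))))
                      (*-cong (e f0 f2) (minor-cong e f1 f2 f0 f1))


module MatrixAlgebra (F : FiniteField) where
  open FieldFacts F

  module PolySyntax {n : ℕ} where
    Poly = Polynomial n
    PMat = Fin 3 → Fin 3 → Poly
    PVec = Fin 3 → Poly

    S3 : (Fin 3 → Poly) → Poly
    S3 f = f f0 :+ (f f1 :+ f f2)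

    mulP : PMat → PMat → PMat
    mulP A B i j = S3 (λ k → A i k :* B k j)

    minorP : PMat → Fin 3 → Fin 3 → Fin 3 → Fin 3 → Poly
    minorP M i i' j j' = M i j :* M i' j' :- M i j' :* M i' j

    detP : PMat → Poly
    detP M = M f0 f0 :* minorP M f1 f2 f1 f2
           :- M f0 f1 :* minorP M f1 f2 f0 f2
           :+ M f0 f2 :* minorP M f1 f2 f0 f1

    vec : Poly → Poly → Poly → PVec
    vec a b c zero = a
    vec a b c (suc zero) = b
    vec a b c (suc (suc zero)) = c

    mat : (a b c d e f g h k : Poly) → PMat
    mat a b c d e f g h k zero = vec a b c
    mat a b c d e f g h k (suc zero) = vec d e f
    mat a b c d e f g h k (suc (suc zero)) = vec g h k

  open PolySyntax

  I3 : Mat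
  I3 zero zero = 1#
  I3 (suc zero) (suc zero) = 1#
  I3 (suc (suc zero)) (suc (suc zero)) = 1#
  I3 _ _ = 0#

  O3 : Mat
  O3 i j = 0#

  tr-I3 : tr I3 ≋ I3
  tr-I3 zero zero = refl
  tr-I3 zero (suc zero) = refl
  tr-I3 zero (suc (suc zero)) = refl
  tr-I3 (suc zero) zero = refl
  tr-I3 (suc zero) (suc zero) = refl
  tr-I3 (suc zero) (suc (suc zero)) = refl
  tr-I3 (suc (suc zero)) zero = refl
  tr-I3 (suc (suc zero)) (suc zero) = refl
  tr-I3 (suc (suc zero)) (suc (suc zero)) = refl

  ⊗-assoc : ∀ A B C → ((A ⊗ B) ⊗ C) ≋ (A ⊗ (B ⊗ C))
  ⊗-assoc A B C i j = solve 15 (λ a0 a1 a2 b00 b01 b02 b10 b11 b12 b20 b21 b22 c0 c1 c2 →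
      let a = vec a0 a1 a2 ; b = mat b00 b01 b02 b10 b11 b12 b20 b21 b22 ; c = vec c0 c1 c2 in
      S3 (λ k → S3 (λ l → a l :* b l k) :* c k) := S3 (λ l → a l :* S3 (λ k → b l k :* c k))) refl
    (A i f0) (A i f1) (A i f2)
    (B f0 f0) (B f0 f1) (B f0 f2) (B f1 f0) (B f1 f1) (B f1 f2) (B f2 f0) (B f2 f1) (B f2 f2)
    (C f0 j) (C f1 j) (C f2 j)

  tr-⊗ : ∀ A B → tr (A ⊗ B) ≋ (tr B ⊗ tr A)
  tr-⊗ A B i j = sum3-cong (λ k → *-comm (A j k) (B k i))

  scale-sum3ˡ : ∀ c (x y : Fin 3 → Carrier) → sum3 (λ k → (c * x k) * y k) ≈ c * sum3 (λ k → x k * y k)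
  scale-sum3ˡ c x y = solve 7 (λ c x0 x1 x2 y0 y1 y2 → let x = vec x0 x1 x2 ; y = vec y0 y1 y2 in
    S3 (λ k → (c :* x k) :* y k) := c :* S3 (λ k → x k :* y k)) refl c (x f0) (x f1) (x f2) (y f0) (y f1) (y f2)

  scale-sum3ʳ : ∀ c (x y : Fin 3 → Carrier) → sum3 (λ k → x k * (c * y k)) ≈ c * sum3 (λ k → x k * y k)
  scale-sum3ʳ c x y = solve 7 (λ c x0 x1 x2 y0 y1 y2 → let x = vec x0 x1 x2 ; y = vec y0 y1 y2 in
    S3 (λ k → x k :* (c :* y k)) := c :* S3 (λ k → x k :* y k)) refl c (x f0) (x f1) (x f2) (y f0) (y f1) (y f2)

  scale-⊗ˡ : ∀ c X Y → (scale c X ⊗ Y) ≋ scale c (X ⊗ Y)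
  scale-⊗ˡ c X Y i j = scale-sum3ˡ c (X i) (λ k → Y k j)

  scale-⊗ʳ : ∀ c X Y → (X ⊗ scale c Y) ≋ scale c (X ⊗ Y)
  scale-⊗ʳ c X Y i j = scale-sum3ʳ c (X i) (λ k → Y k j)

  scale-scale : ∀ a b N → scale a (scale b N) ≋ scale (a * b) N
  scale-scale a b N i j = sym (*-assoc _ _ _)

  I3-⊗ : ∀ X → (I3 ⊗ X) ≋ X
  I3-⊗ X zero j = solve 3 (λ x0 x1 x2 → con (+ 1) :* x0 :+ (con (+ 0) :* x1 :+ con (+ 0) :* x2) := x0) refl (X f0 j) (X f1 j) (X f2 j)
  I3-⊗ X (suc zero) j = solve 3 (λ x0 x1 x2 → con (+ 0) :* x0 :+ (con (+ 1) :* x1 :+ con (+ 0) :* x2) := x1) refl (X f0 j) (X f1 j) (X f2 j)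
  I3-⊗ X (suc (suc zero)) j = solve 3 (λ x0 x1 x2 → con (+ 0) :* x0 :+ (con (+ 0) :* x1 :+ con (+ 1) :* x2) := x2) refl (X f0 j) (X f1 j) (X f2 j)

  ⊗-I3 : ∀ X → (X ⊗ I3) ≋ X
  ⊗-I3 X i j = trans (sum3-cong (λ k → trans (*-comm (X i k) (I3 k j)) (*-congʳ (tr-I3 j k)))) (I3-⊗ (tr X) j i)

  dI-⊗ : ∀ d X → (scale d I3 ⊗ X) ≋ scale d X
  dI-⊗ d X = ≋-trans (scale-⊗ˡ d I3 X) (scale-cong refl (I3-⊗ X))

  ⊗-dI : ∀ d X → (X ⊗ scale d I3) ≋ scale d X
  ⊗-dI d X = ≋-trans (scale-⊗ʳ d X I3) (scale-cong refl (⊗-I3 X))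

  tr-dI : ∀ d → tr (scale d I3) ≋ scale d I3
  tr-dI d i j = *-congˡ (tr-I3 i j)

  act-act : ∀ X Y N → act X (act Y N) ≋ act (X ⊗ Y) N
  act-act X Y N = ≋-sym (begin
      ((X ⊗ Y) ⊗ N) ⊗ tr (X ⊗ Y)        ≈⟨ ⊗-cong {A = (X ⊗ Y) ⊗ N} ≋-refl (tr-⊗ X Y) ⟩
      ((X ⊗ Y) ⊗ N) ⊗ (tr Y ⊗ tr X)     ≈⟨ ≋-sym (⊗-assoc ((X ⊗ Y) ⊗ N) (tr Y) (tr X)) ⟩
      (((X ⊗ Y) ⊗ N) ⊗ tr Y) ⊗ tr X     ≈⟨ ⊗-cong {B = tr X} (⊗-cong {B = tr Y} (⊗-assoc X Y N) ≋-refl) ≋-refl ⟩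
      ((X ⊗ (Y ⊗ N)) ⊗ tr Y) ⊗ tr X     ≈⟨ ⊗-cong {B = tr X} (⊗-assoc X (Y ⊗ N) (tr Y)) ≋-refl ⟩
      (X ⊗ ((Y ⊗ N) ⊗ tr Y)) ⊗ tr X     ∎)
    where open ≋-Reasoning

  act-dI : ∀ d N → act (scale d I3) N ≋ scale (d * d) N
  act-dI d N = begin
      (scale d I3 ⊗ N) ⊗ tr (scale d I3)   ≈⟨ ⊗-cong (dI-⊗ d N) (tr-dI d) ⟩
      scale d N ⊗ scale d I3               ≈⟨ ⊗-dI d (scale d N) ⟩
      scale d (scale d N)                  ≈⟨ scale-scale d d N ⟩
      scale (d * d) N                      ∎
    where open ≋-Reasoning

  act-scale : ∀ C c N → act C (scale c N) ≋ scale c (act C N)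
  act-scale C c N = ≋-trans (⊗-cong {B = tr C} (scale-⊗ʳ c C N) ≋-refl) (scale-⊗ˡ c (C ⊗ N) (tr C))

  act-O3 : ∀ C → act C O3 ≋ O3
  act-O3 C i j = trans (sum3-cong (λ k → trans (*-congʳ (row k)) (zeroˡ (C j k)))) zero3
    where
    zero3 : 0# + (0# + 0#) ≈ 0#
    zero3 = trans (+-identityˡ _) (+-identityˡ 0#)
    row : ∀ k → (C ⊗ O3) i k ≈ 0#
    row k = trans (sum3-cong (λ l → zeroʳ (C i l))) zero3

  act-lin : ∀ C N s Q → act C (N +M scale s Q) ≋ (act C N +M scale s (act C Q))
  act-lin C N s Q i j = solve 25 (λ a0 a1 a2 b0 b1 b2 n00 n01 n02 n10 n11 n12 n20 n21 n22 q00 q01 q02 q10 q11 q12 q20 q21 q22 s →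
      let a = vec a0 a1 a2 ; b = vec b0 b1 b2
          n = mat n00 n01 n02 n10 n11 n12 n20 n21 n22
          q = mat q00 q01 q02 q10 q11 q12 q20 q21 q22
      in S3 (λ k → S3 (λ l → a l :* (n l k :+ s :* q l k)) :* b k)
         := S3 (λ k → S3 (λ l → a l :* n l k) :* b k) :+ s :* S3 (λ k → S3 (λ l → a l :* q l k) :* b k)) refl
    (C i f0) (C i f1) (C i f2) (C j f0) (C j f1) (C j f2)
    (N f0 f0) (N f0 f1) (N f0 f2) (N f1 f0) (N f1 f1) (N f1 f2) (N f2 f0) (N f2 f1) (N f2 f2)
    (Q f0 f0) (Q f0 f1) (Q f0 f2) (Q f1 f0) (Q f1 f1) (Q f1 f2) (Q f2 f0) (Q f2 f1) (Q f2 f2) s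

  mv : Mat → Vec3 → Vec3
  mv C x i = sum3 (λ k → C i k * x k)

  mv-cong : ∀ {X X' w w'} → X ≋ X' → (∀ k → w k ≈ w' k) → ∀ i → mv X w i ≈ mv X' w' i
  mv-cong e f i = sum3-cong (λ k → *-cong (e i k) (f k))

  mv-⊗ : ∀ X Y w i → mv (X ⊗ Y) w i ≈ mv X (mv Y w) i
  mv-⊗ X Y w i = ⊗-assoc X Y (λ k _ → w k) i f0

  mv-scale : ∀ c X w i → mv (scale c X) w i ≈ c * mv X w i
  mv-scale c X w i = scale-sum3ˡ c (X i) w

  mv-vscale : ∀ c X w i → mv X (λ k → c * w k) i ≈ c * mv X w i
  mv-vscale c X w i = scale-sum3ʳ c (X i) w

  mv-I3 : ∀ w i → mv I3 w i ≈ w i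
  mv-I3 w i = I3-⊗ (λ k _ → w k) i f0

  outer-mv : ∀ d C x → outer (λ i → d * mv C x i) ≋ scale (d * d) (act C (outer x))
  outer-mv d C x i j = solve 10 (λ d a0 a1 a2 b0 b1 b2 x0 x1 x2 →
      let a = vec a0 a1 a2 ; b = vec b0 b1 b2 ; x = vec x0 x1 x2 in
      (d :* S3 (λ k → a k :* x k)) :* (d :* S3 (λ k → b k :* x k))
      := (d :* d) :* S3 (λ k → S3 (λ l → a l :* (x l :* x k)) :* b k)) refl
    d (C i f0) (C i f1) (C i f2) (C j f0) (C j f1) (C j f2) (x f0) (x f1) (x f2)

  -- Cauchy–Binet for 2×2 minors of a product
  minor-⊗ : ∀ X Y i i' j j' → minor (X ⊗ Y) i i' j j' ≈
              minor X i i' f0 f1 * minor Y f0 f1 j j'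
            + (minor X i i' f0 f2 * minor Y f0 f2 j j' + minor X i i' f1 f2 * minor Y f1 f2 j j')
  minor-⊗ X Y i i' j j' = solve 12 (λ a0 a1 a2 b0 b1 b2 c0 c1 c2 d0 d1 d2 →
      (a0 :* c0 :+ (a1 :* c1 :+ a2 :* c2)) :* (b0 :* d0 :+ (b1 :* d1 :+ b2 :* d2))
        :- (a0 :* d0 :+ (a1 :* d1 :+ a2 :* d2)) :* (b0 :* c0 :+ (b1 :* c1 :+ b2 :* c2))
      := (a0 :* b1 :- a1 :* b0) :* (c0 :* d1 :- d0 :* c1)
         :+ ((a0 :* b2 :- a2 :* b0) :* (c0 :* d2 :- d0 :* c2) :+ (a1 :* b2 :- a2 :* b1) :* (c1 :* d2 :- d1 :* c2))) refl
    (X i f0) (X i f1) (X i f2) (X i' f0) (X i' f1) (X i' f2)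
    (Y f0 j) (Y f1 j) (Y f2 j) (Y f0 j') (Y f1 j') (Y f2 j')

  minor-scale : ∀ c N i i' j j' → minor (scale c N) i i' j j' ≈ (c * c) * minor N i i' j j'
  minor-scale c N i i' j j' = solve 5 (λ c a b x y → (c :* a) :* (c :* b) :- (c :* x) :* (c :* y) := (c :* c) :* (a :* b :- x :* y)) refl
    c (N i j) (N i' j') (N i j') (N i' j)

  det-scale : ∀ c X → det (scale c X) ≈ (c * (c * c)) * det X
  det-scale c X = solve 10 (λ c x00 x01 x02 x10 x11 x12 x20 x21 x22 →
      let x = mat x00 x01 x02 x10 x11 x12 x20 x21 x22
      in detP (λ i j → c :* x i j) := (c :* (c :* c)) :* detP x) refl
    c (X f0 f0) (X f0 f1) (X f0 f2) (X f1 f0) (X f1 f1) (X f1 f2) (X f2 f0) (X f2 f1) (X f2 f2)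

  det-⊗ : ∀ X Y → det (X ⊗ Y) ≈ det X * det Y
  det-⊗ X Y = solve 18 (λ x00 x01 x02 x10 x11 x12 x20 x21 x22 y00 y01 y02 y10 y11 y12 y20 y21 y22 →
      let x = mat x00 x01 x02 x10 x11 x12 x20 x21 x22
          y = mat y00 y01 y02 y10 y11 y12 y20 y21 y22
      in detP (mulP x y) := detP x :* detP y) refl
    (X f0 f0) (X f0 f1) (X f0 f2) (X f1 f0) (X f1 f1) (X f1 f2) (X f2 f0) (X f2 f1) (X f2 f2)
    (Y f0 f0) (Y f0 f1) (Y f0 f2) (Y f1 f0) (Y f1 f1) (Y f1 f2) (Y f2 f0) (Y f2 f1) (Y f2 f2)

  varMat : PMat {9}
  varMat = mat (var (# 0)) (var (# 1)) (var (# 2)) (var (# 3)) (var (# 4))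
               (var (# 5)) (var (# 6)) (var (# 7)) (var (# 8))

  entries : Mat → Vec Carrier 9
  entries A = A f0 f0 ∷ A f0 f1 ∷ A f0 f2 ∷ A f1 f0 ∷ A f1 f1 ∷ A f1 f2 ∷ A f2 f0 ∷ A f2 f1 ∷ A f2 f2 ∷ []

  adj : Mat → Mat
  adj A zero zero = minor A f1 f2 f1 f2
  adj A zero (suc zero) = - minor A f0 f2 f1 f2
  adj A zero (suc (suc zero)) = minor A f0 f1 f1 f2
  adj A (suc zero) zero = - minor A f1 f2 f0 f2
  adj A (suc zero) (suc zero) = minor A f0 f2 f0 f2
  adj A (suc zero) (suc (suc zero)) = - minor A f0 f1 f0 f2
  adj A (suc (suc zero)) zero = minor A f1 f2 f0 f1
  adj A (suc (suc zero)) (suc zero) = - minor A f0 f2 f0 f1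
  adj A (suc (suc zero)) (suc (suc zero)) = minor A f0 f1 f0 f1

  adjP : PMat {9}
  adjP = mat (minorP X f1 f2 f1 f2) (:- minorP X f0 f2 f1 f2) (minorP X f0 f1 f1 f2)
             (:- minorP X f1 f2 f0 f2) (minorP X f0 f2 f0 f2) (:- minorP X f0 f1 f0 f2)
             (minorP X f1 f2 f0 f1) (:- minorP X f0 f2 f0 f1) (minorP X f0 f1 f0 f1)
    where X = varMat

  adj-r : ∀ A → (A ⊗ adj A) ≋ scale (det A) I3
  adj-r A zero zero = prove (entries A) (mulP varMat adjP f0 f0) (detP varMat :* con (+ 1)) refl
  adj-r A zero (suc zero) = prove (entries A) (mulP varMat adjP f0 f1) (detP varMat :* con (+ 0)) refl
  adj-r A zero (suc (suc zero)) = prove (entries A) (mulP varMat adjP f0 f2) (detP varMat :* con (+ 0)) refl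
  adj-r A (suc zero) zero = prove (entries A) (mulP varMat adjP f1 f0) (detP varMat :* con (+ 0)) refl
  adj-r A (suc zero) (suc zero) = prove (entries A) (mulP varMat adjP f1 f1) (detP varMat :* con (+ 1)) refl
  adj-r A (suc zero) (suc (suc zero)) = prove (entries A) (mulP varMat adjP f1 f2) (detP varMat :* con (+ 0)) refl
  adj-r A (suc (suc zero)) zero = prove (entries A) (mulP varMat adjP f2 f0) (detP varMat :* con (+ 0)) refl
  adj-r A (suc (suc zero)) (suc zero) = prove (entries A) (mulP varMat adjP f2 f1) (detP varMat :* con (+ 0)) refl
  adj-r A (suc (suc zero)) (suc (suc zero)) = prove (entries A) (mulP varMat adjP f2 f2) (detP varMat :* con (+ 1)) refl

  adj-l : ∀ A → (adj A ⊗ A) ≋ scale (det A) I3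
  adj-l A zero zero = prove (entries A) (mulP adjP varMat f0 f0) (detP varMat :* con (+ 1)) refl
  adj-l A zero (suc zero) = prove (entries A) (mulP adjP varMat f0 f1) (detP varMat :* con (+ 0)) refl
  adj-l A zero (suc (suc zero)) = prove (entries A) (mulP adjP varMat f0 f2) (detP varMat :* con (+ 0)) refl
  adj-l A (suc zero) zero = prove (entries A) (mulP adjP varMat f1 f0) (detP varMat :* con (+ 0)) refl
  adj-l A (suc zero) (suc zero) = prove (entries A) (mulP adjP varMat f1 f1) (detP varMat :* con (+ 1)) refl
  adj-l A (suc zero) (suc (suc zero)) = prove (entries A) (mulP adjP varMat f1 f2) (detP varMat :* con (+ 0)) refl
  adj-l A (suc (suc zero)) zero = prove (entries A) (mulP adjP varMat f2 f0) (detP varMat :* con (+ 0)) refl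
  adj-l A (suc (suc zero)) (suc zero) = prove (entries A) (mulP adjP varMat f2 f1) (detP varMat :* con (+ 0)) refl
  adj-l A (suc (suc zero)) (suc (suc zero)) = prove (entries A) (mulP adjP varMat f2 f2) (detP varMat :* con (+ 1)) refl


module Invariance (F : FiniteField) where
  open FieldFacts F
  open MatrixAlgebra F

  record QuasiInverse (C : Mat) : Set where
    field
      C'    : Mat
      d     : Carrier
      d≉0   : NZ d
      left  : (C' ⊗ C) ≋ scale d I3
      right : (C ⊗ C') ≋ scale d I3

  adjugate-inverse : ∀ A → Invertible A → QuasiInverse A
  adjugate-inverse A det≉0 = record
    { C' = adj A ; d = det A ; d≉0 = det≉0 ; left = adj-l A ; right = adj-r A }

  flip : ∀ {C} (Q : QuasiInverse C) → QuasiInverse (QuasiInverse.C' Q)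
  flip {C} Q = record { C' = C ; d = d ; d≉0 = d≉0 ; left = right ; right = left }
    where open QuasiInverse Q

  undo-act : ∀ {C} (Q : QuasiInverse C) N → act (QuasiInverse.C' Q) (act C N) ≋ scale (QuasiInverse.d Q * QuasiInverse.d Q) N
  undo-act {C} Q N = ≋-trans (act-act C' C N) (≋-trans (act-cong {C' ⊗ C} {scale d I3} {N} {N} left ≋-refl) (act-dI d N))
    where open QuasiInverse Q

  undo-scale : ∀ c (nz : NZ c) N → scale (inv c nz) (scale c N) ≋ N
  undo-scale c nz N i j = trans (sym (*-assoc _ _ _)) (trans (*-congʳ (inv-l c nz)) (*-identityˡ _))

  record Invariant (P : Mat → Set) : Set where
    field
      resp   : ∀ {M N} → M ≋ N → P M → P N
      act⁺   : ∀ {C} → QuasiInverse C → ∀ N → P N → P (act C N)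
      scale⁺ : ∀ c → NZ c → ∀ N → P N → P (scale c N)

    scale⁻ : ∀ c → NZ c → ∀ N → P (scale c N) → P N
    scale⁻ c nz N p = resp (undo-scale c nz N) (scale⁺ (inv c nz) (inv-nz c nz) (scale c N) p)

    act⁻ : ∀ {C} (Q : QuasiInverse C) N → P (act C N) → P N
    act⁻ Q N p = scale⁻ (d * d) (mulNZ d≉0 d≉0) N (resp (undo-act Q N) (act⁺ (flip Q) _ p))
      where open QuasiInverse Q
  open Invariant public

  invariant-¬ : ∀ {P} → Invariant P → Invariant (λ N → ¬ P N)
  invariant-¬ g = record
    { resp = λ e np p → np (resp g (≋-sym e) p)
    ; act⁺ = λ Q N np p → np (act⁻ g Q N p)
    ; scale⁺ = λ c nz N np p → np (scale⁻ g c nz N p) }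

  invariant-× : ∀ {P Q} → Invariant P → Invariant Q → Invariant (λ N → P N × Q N)
  invariant-× g h = record
    { resp = λ e pq → resp g e (proj₁ pq) , resp h e (proj₂ pq)
    ; act⁺ = λ Q N pq → act⁺ g Q N (proj₁ pq) , act⁺ h Q N (proj₂ pq)
    ; scale⁺ = λ c nz N pq → scale⁺ g c nz N (proj₁ pq) , scale⁺ h c nz N (proj₂ pq) }

  allZero-invariant : Invariant AllZero
  allZero-invariant = record
    { resp = λ e z i j → trans (sym (e i j)) (z i j)
    ; act⁺ = λ {C} _ N z i j → trans (act-cong {C} {C} {N} {O3} ≋-refl z i j) (act-O3 C i j)
    ; scale⁺ = λ c nz N z i j → trans (*-congˡ (z i j)) (zeroʳ _) }

  sum-of-zeros : ∀ {a b c x y z} → x ≈ 0# → y ≈ 0# → z ≈ 0# → a * x + (b * y + c * z) ≈ 0#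
  sum-of-zeros x≈0 y≈0 z≈0 =
    trans (+-cong (kill x≈0) (+-cong (kill y≈0) (kill z≈0))) (trans (+-congˡ (+-identityˡ 0#)) (+-identityˡ 0#))
    where
    kill : ∀ {a x} → x ≈ 0# → a * x ≈ 0#
    kill x≈0 = trans (*-congˡ x≈0) (zeroʳ _)

  -- by Cauchy–Binet, a product with a factor of rank ≤ 1 has rank ≤ 1
  minorsZero-⊗ʳ : ∀ X Y → AllMinorsZero Y → AllMinorsZero (X ⊗ Y)
  minorsZero-⊗ʳ X Y z i i' j j' = trans (minor-⊗ X Y i i' j j') (sum-of-zeros (z f0 f1 j j') (z f0 f2 j j') (z f1 f2 j j'))

  minorsZero-⊗ˡ : ∀ X Y → AllMinorsZero X → AllMinorsZero (X ⊗ Y)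
  minorsZero-⊗ˡ X Y z i i' j j' = trans (minor-⊗ X Y i i' j j')
    (trans (+-cong (*-comm _ _) (+-cong (*-comm _ _) (*-comm _ _))) (sum-of-zeros (z i i' f0 f1) (z i i' f0 f2) (z i i' f1 f2)))

  minorsZero-scale : ∀ c N → AllMinorsZero N → AllMinorsZero (scale c N)
  minorsZero-scale c N z i i' j j' = trans (minor-scale c N i i' j j') (trans (*-congˡ (z i i' j j')) (zeroʳ _))

  allMinorsZero-invariant : Invariant AllMinorsZero
  allMinorsZero-invariant = record
    { resp = λ e z i i' j j' → trans (sym (minor-cong e i i' j j')) (z i i' j j')
    ; act⁺ = λ {C} _ N z → minorsZero-⊗ˡ (C ⊗ N) (tr C) (minorsZero-⊗ʳ C N z)
    ; scale⁺ = λ c _ → minorsZero-scale c }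

  DetZero : Mat → Set
  DetZero N = det N ≈ 0#

  detZero-invariant : Invariant DetZero
  detZero-invariant = record
    { resp = λ e z → trans (sym (det-cong e)) z
    ; act⁺ = λ {C} _ N z → trans (det-⊗ (C ⊗ N) (tr C))
        (trans (*-congʳ (trans (det-⊗ C N) (trans (*-congˡ z) (zeroʳ _)))) (zeroˡ _))
    ; scale⁺ = λ c _ N z → trans (det-scale c N) (trans (*-congˡ z) (zeroʳ _)) }

  rank1-invariant : Invariant Rank1
  rank1-invariant = invariant-× (invariant-¬ allZero-invariant) allMinorsZero-invariant

  rank2-invariant : Invariant Rank2
  rank2-invariant = invariant-× (invariant-¬ allMinorsZero-invariant) detZero-invariant

  rank3-invariant : Invariant Rank3
  rank3-invariant = invariant-¬ detZero-invariant

  conic-act : ∀ {C} (Q : QuasiInverse C) N x → OnConicOf N x →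
              OnConicOf (act C N) (λ i → QuasiInverse.d Q * mv C x i)
  conic-act {C} Q N x (x≠0 , w , x≈Nw) = image≠0 , mv (tr C') w , λ i → sym (image i)
    where
    open QuasiInverse Q
    cancel-right : (act C N ⊗ tr C') ≋ scale d (C ⊗ N)
    cancel-right = begin
      ((C ⊗ N) ⊗ tr C) ⊗ tr C'    ≈⟨ ⊗-assoc (C ⊗ N) (tr C) (tr C') ⟩
      (C ⊗ N) ⊗ (tr C ⊗ tr C')    ≈⟨ ⊗-cong {A = C ⊗ N} ≋-refl (≋-sym (tr-⊗ C' C)) ⟩
      (C ⊗ N) ⊗ tr (C' ⊗ C)       ≈⟨ ⊗-cong {A = C ⊗ N} ≋-refl (≋-trans (tr-cong left) (tr-dI d)) ⟩
      (C ⊗ N) ⊗ scale d I3        ≈⟨ ⊗-dI d (C ⊗ N) ⟩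
      scale d (C ⊗ N)             ∎
      where open ≋-Reasoning
    image : ∀ i → mv (act C N) (mv (tr C') w) i ≈ d * mv C x i
    image i = begin
      mv (act C N) (mv (tr C') w) i   ≈⟨ sym (mv-⊗ (act C N) (tr C') w i) ⟩
      mv (act C N ⊗ tr C') w i        ≈⟨ mv-cong {w = w} {w' = w} cancel-right (λ k → refl) i ⟩
      mv (scale d (C ⊗ N)) w i        ≈⟨ mv-scale d (C ⊗ N) w i ⟩
      d * mv (C ⊗ N) w i              ≈⟨ *-congˡ (mv-⊗ C N w i) ⟩
      d * mv C (mv N w) i             ≈⟨ *-congˡ (mv-cong {X = C} ≋-refl (λ k → sym (x≈Nw k)) i) ⟩
      d * mv C x i                    ∎
      where open ≈-Reasoning
    -- C x = 0 forces x = C'(C x)/d = 0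
    image≠0 : NonzeroVec (λ i → d * mv C x i)
    image≠0 z = x≠0 (λ i → cancel0 d≉0 (begin
      d * x i             ≈⟨ *-congˡ (sym (mv-I3 x i)) ⟩
      d * mv I3 x i       ≈⟨ sym (mv-scale d I3 x i) ⟩
      mv (scale d I3) x i ≈⟨ mv-cong {w = x} {w' = x} (≋-sym left) (λ k → refl) i ⟩
      mv (C' ⊗ C) x i     ≈⟨ mv-⊗ C' C x i ⟩
      mv C' (mv C x) i    ≈⟨ mv-cong {X = C'} ≋-refl (λ k → cancel0 d≉0 (z k)) i ⟩
      mv C' (λ _ → 0#) i  ≈⟨ sum-of-zeros refl refl refl ⟩
      0#                  ∎))
      where open ≈-Reasoning

  tangent-act : ∀ {C} (Q : QuasiInverse C) N x →
                (∀ t → ¬ Rank1 (N +M scale t (outer x))) →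
                ∀ t → ¬ Rank1 (act C N +M scale t (outer (λ i → QuasiInverse.d Q * mv C x i)))
  tangent-act {C} Q N x tangent t r1 =
    tangent (t * (d * d)) (act⁻ rank1-invariant Q _ (resp rank1-invariant line-image r1))
    where
    open QuasiInverse Q
    line-image : (act C N +M scale t (outer (λ i → d * mv C x i))) ≋ act C (N +M scale (t * (d * d)) (outer x))
    line-image = begin
      act C N +M scale t (outer (λ i → d * mv C x i))        ≈⟨ +M-cong {M = act C N} ≋-refl (scale-cong {c = t} refl (outer-mv d C x)) ⟩
      act C N +M scale t (scale (d * d) (act C (outer x)))   ≈⟨ +M-cong {M = act C N} ≋-refl (scale-scale t (d * d) (act C (outer x))) ⟩
      act C N +M scale (t * (d * d)) (act C (outer x))       ≈⟨ ≋-sym (act-lin C N (t * (d * d)) (outer x)) ⟩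
      act C (N +M scale (t * (d * d)) (outer x))             ∎
      where open ≋-Reasoning

  exterior-invariant : Invariant Exterior
  exterior-invariant = record { resp = respects ; act⁺ = acted ; scale⁺ = scaled }
    where
    respects : ∀ {M N} → M ≋ N → Exterior M → Exterior N
    respects {M} {N} e (r2 , x , (x≠0 , w , x≈Mw) , tangent) =
      resp rank2-invariant e r2 , x ,
      (x≠0 , w , (λ i → trans (x≈Mw i) (mv-cong {w = w} {w' = w} e (λ k → refl) i))) ,
      (λ t r1 → tangent t (resp rank1-invariant (+M-cong {N = scale t (outer x)} (≋-sym e) ≋-refl) r1))

    acted : ∀ {C} → QuasiInverse C → ∀ N → Exterior N → Exterior (act C N)
    acted Q N (r2 , x , onConic , tangent) =
      act⁺ rank2-invariant Q N r2 , _ , conic-act Q N x onConic , tangent-act Q N x tangent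

    scaled : ∀ c → NZ c → ∀ N → Exterior N → Exterior (scale c N)
    scaled c nz N (r2 , x , (x≠0 , w , x≈Nw) , tangent) =
      scale⁺ rank2-invariant c nz N r2 , x , (x≠0 , (λ k → ic * w k) , λ i → sym (onConic i)) , tangent'
      where
      ic = inv c nz
      onConic : ∀ i → mv (scale c N) (λ k → ic * w k) i ≈ x i
      onConic i = begin
        mv (scale c N) (λ k → ic * w k) i   ≈⟨ mv-scale c N (λ k → ic * w k) i ⟩
        c * mv N (λ k → ic * w k) i         ≈⟨ *-congˡ (mv-vscale ic N w i) ⟩
        c * (ic * mv N w i)                 ≈⟨ sym (*-assoc _ _ _) ⟩
        (c * ic) * mv N w i                 ≈⟨ trans (*-congʳ (inv-r c nz)) (*-identityˡ _) ⟩
        mv N w i                            ≈⟨ sym (x≈Nw i) ⟩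
        x i                                 ∎
        where open ≈-Reasoning
      line-image : ∀ t → (scale c N +M scale t (outer x)) ≋ scale c (N +M scale (ic * t) (outer x))
      line-image t i j = sym (trans (distribˡ c _ _) (+-congˡ (trans (sym (*-assoc _ _ _))
                         (*-congʳ (trans (sym (*-assoc _ _ _)) (trans (*-congʳ (inv-r c nz)) (*-identityˡ t)))))))
      tangent' : ∀ t → ¬ Rank1 (scale c N +M scale t (outer x))
      tangent' t r1 = tangent (ic * t) (scale⁻ rank1-invariant c nz _ (resp rank1-invariant (line-image t) r1))

  interior-invariant : Invariant Interior
  interior-invariant = invariant-× rank2-invariant (invariant-¬ exterior-invariant)

  proportional-resp : ∀ {M N M' N'} → M ≋ N → M' ≋ N' → Proportional M M' → Proportional N N'
  proportional-resp e f (c , nz , g) = c , nz , λ i j → trans (sym (e i j)) (trans (g i j) (*-congˡ (f i j)))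

  proportional-act : ∀ C {M M'} → Proportional M M' → Proportional (act C M) (act C M')
  proportional-act C {M} {M'} (c , nz , e) = c , nz , ≋-trans (act-cong {C} {C} {M} {scale c M'} ≋-refl e) (act-scale C c M')

  proportional-act⁻ : ∀ {C} (Q : QuasiInverse C) {M M'} → Proportional (act C M) (act C M') → Proportional M M'
  proportional-act⁻ {C} Q {M} {M'} p = c , c≉0 , λ i j → cancel dd≉0 (trans (e i j) (swap c (M' i j)))
    where
    open QuasiInverse Q
    dd≉0 = mulNZ d≉0 d≉0
    rescaled : Proportional (scale (d * d) M) (scale (d * d) M')
    rescaled = proportional-resp (undo-act Q M) (undo-act Q M') (proportional-act C' p)
    c = proj₁ rescaled
    c≉0 = proj₁ (proj₂ rescaled)
    e = proj₂ (proj₂ rescaled)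
    swap : ∀ a b → a * ((d * d) * b) ≈ (d * d) * (a * b)
    swap a b = trans (sym (*-assoc _ _ _)) (trans (*-congʳ (*-comm _ _)) (*-assoc _ _ _))


module Counting {X : Set} (R : X → X → Set) where

  Distinct : List X → Set
  Distinct = AllPairs (λ a b → ¬ R a b)

  Covered : List X → List X → Set
  Covered L₁ L₂ = All (λ a → Any (R a) L₂) L₁

  remove : ∀ {P : X → Set} (L : List X) → Any P L → List X
  remove (x ∷ L) (here _) = L
  remove (x ∷ L) (there p) = x ∷ remove L p

  length-remove : ∀ {P : X → Set} (L : List X) (p : Any P L) → length L ≡ ℕ.suc (length (remove L p))
  length-remove (x ∷ L) (here _) = ≡.refl
  length-remove (x ∷ L) (there p) = ≡.cong ℕ.suc (length-remove L p)

  any-remove : ∀ {P Q : X → Set} (L : List X) (p : Any P L) → Any Q L → Any Q (remove L p) ⊎ Σ X (λ x → P x × Q x)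
  any-remove (x ∷ L) (here px) (here qx) = inj₂ (x , px , qx)
  any-remove (x ∷ L) (here px) (there q) = inj₁ q
  any-remove (x ∷ L) (there p) (here qx) = inj₁ (here qx)
  any-remove (x ∷ L) (there p) (there q) with any-remove L p q
  ... | inj₁ r = inj₁ (there r)
  ... | inj₂ r = inj₂ r

  module _ (euclidean : ∀ {a b c} → R a c → R b c → R a b) where

    -- pigeonhole: each entry of L₁ uses up its own entry of L₂
    card-≤ : ∀ L₁ L₂ → Distinct L₁ → Covered L₁ L₂ → length L₁ ≤ length L₂
    card-≤ [] L₂ _ _ = z≤n
    card-≤ (a ∷ L₁) L₂ (a≁L₁ ∷ distinct) (a∈L₂ ∷ covered) rewrite length-remove L₂ a∈L₂ =
      s≤s (card-≤ L₁ (remove L₂ a∈L₂) distinct (still-covered L₁ a≁L₁ covered))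
      where
      still-covered : ∀ K → All (λ b → ¬ R a b) K → Covered K L₂ → Covered K (remove L₂ a∈L₂)
      still-covered [] _ _ = []
      still-covered (b ∷ K) (a≁b ∷ a≁K) (b∈L₂ ∷ K⊆L₂) with any-remove L₂ a∈L₂ b∈L₂
      ... | inj₁ b∈rest = b∈rest ∷ still-covered K a≁K K⊆L₂
      ... | inj₂ (c , a~c , b~c) = ⊥-elim (a≁b (euclidean a~c b~c))

    card-≡ : ∀ L₁ L₂ → Distinct L₁ → Distinct L₂ → Covered L₁ L₂ → Covered L₂ L₁ → length L₁ ≡ length L₂
    card-≡ L₁ L₂ d₁ d₂ c₁₂ c₂₁ = ℕP.≤-antisym (card-≤ L₁ L₂ d₁ c₁₂) (card-≤ L₂ L₁ d₂ c₂₁)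

length-cartesianProduct : ∀ {A B : Set} (xs : List A) (ys : List B) →
                          length (cartesianProduct xs ys) ≡ length xs ℕ.* length ys
length-cartesianProduct [] ys = ≡.refl
length-cartesianProduct (x ∷ xs) ys =
  ≡.trans (ListP.length-++ (map (x ,_) ys)) (≡.cong₂ ℕ._+_ (ListP.length-map (x ,_) ys) (length-cartesianProduct xs ys))

length-filter-split : ∀ {A : Set} {P : A → Set} (P? : Decidable P) xs →
                      length (filter P? xs) ℕ.+ length (filter (∁? P?) xs) ≡ length xs
length-filter-split P? [] = ≡.refl
length-filter-split P? (x ∷ xs) with P? x
... | yes _ = ≡.cong ℕ.suc (length-filter-split P? xs)
... | no _ = ≡.trans (ℕP.+-suc _ _) (≡.cong ℕ.suc (length-filter-split P? xs))

any-filter : ∀ {A : Set} {P Q : A → Set} (P? : Decidable P) {xs} → Any (λ y → Q y × P y) xs → Any Q (filter P? xs)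
any-filter P? p with AnyP.filter⁺ P? p
... | inj₁ q = Any.map proj₁ q
... | inj₂ ¬P = ⊥-elim (¬P (proj₂ (AnyP.lookup-result p)))


-- Its rank is governed by
-- γ and the binary form D(α,β) = εα² − β², which is anisotropic because ε
-- is a nonsquare: rank 1 ⇔ α = β = 0; rank 3 ⇔ γ ≠ 0 and (α,β) ≠ 0;
-- rank 2 ⇔ γ = 0 and (α,β) ≠ 0.
module StandardPlane (F : FiniteField) (ε : FiniteField.Carrier F)
       (nonsquare : ¬ (Σ (FiniteField.Carrier F) λ x → FiniteField._≈_ F (FiniteField._*_ F x x) ε)) where
  open FieldFacts F
  open Invariance F

  σ : Carrier → Carrier → Carrier → Mat
  σ = sigma6Mat ε

  D : Carrier → Carrier → Carrier
  D α β = α * (ε * α) - β * β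

  ε≉0 : NZ ε
  ε≉0 ε≈0 = nonsquare (0# , trans (zeroʳ 0#) (sym ε≈0))

  -- D is anisotropic: D(α,β) = 0 with α ≠ 0 would make ε = (β/α)² a square
  D-anisotropic : ∀ {α β} → D α β ≈ 0# → BothZero α β
  D-anisotropic {α} {β} D≈0 with α ≟ 0#
  ... | yes α≈0 = α≈0 , square-zero (begin
      β * β                        ≈⟨ sym (diff-zero D≈0) ⟩
      α * (ε * α)                  ≈⟨ trans (*-congʳ α≈0) (zeroˡ _) ⟩
      0#                           ∎)
    where open ≈-Reasoning
  ... | no α≉0 = ⊥-elim (nonsquare (β * ia , square))
    where
    open ≈-Reasoning
    ia = inv α α≉0
    square : (β * ia) * (β * ia) ≈ ε
    square = begin
      (β * ia) * (β * ia)        ≈⟨ solve 2 (λ b i → (b :* i) :* (b :* i) := (b :* b) :* (i :* i)) refl β ia ⟩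
      (β * β) * (ia * ia)        ≈⟨ *-congʳ (sym (diff-zero D≈0)) ⟩
      (α * (ε * α)) * (ia * ia)  ≈⟨ solve 3 (λ a e i → (a :* (e :* a)) :* (i :* i) := e :* ((a :* i) :* (a :* i))) refl α ε ia ⟩
      ε * ((α * ia) * (α * ia))  ≈⟨ *-congˡ (*-cong (inv-r α α≉0) (inv-r α α≉0)) ⟩
      ε * (1# * 1#)              ≈⟨ trans (*-congˡ (*-identityˡ 1#)) (*-identityʳ ε) ⟩
      ε                          ∎

  D≉0 : ∀ {α β} → NotBothZero α β → NZ (D α β)
  D≉0 nbz D≈0 = nbz (D-anisotropic D≈0)

  det-σ : ∀ α β γ → det (σ α β γ) ≈ γ * D α β
  det-σ α β γ = solve 4 (λ a b g e →
      a :* ((e :* a) :* g :- con (+ 0) :* con (+ 0)) :- b :* (b :* g :- con (+ 0) :* con (+ 0))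
        :+ con (+ 0) :* (b :* con (+ 0) :- (e :* a) :* con (+ 0))
      := g :* (a :* (e :* a) :- b :* b)) refl α β γ ε

  -- for α = β = 0, σ(α,β,γ) = γ e₃e₃ᵀ has rank ≤ 1
  outer-minorsZero : ∀ x → AllMinorsZero (outer x)
  outer-minorsZero x i i' j j' =
    solve 4 (λ a b c d → (a :* b) :* (c :* d) :- (a :* d) :* (c :* b) := con (+ 0)) refl (x i) (x j) (x i') (x j')

  vec3 : Carrier → Carrier → Carrier → Vec3
  vec3 a b c zero = a
  vec3 a b c (suc zero) = b
  vec3 a b c (suc (suc zero)) = c

  σ-minorsZero : ∀ {α β} γ → BothZero α β → AllMinorsZero (σ α β γ)
  σ-minorsZero {α} {β} γ (α≈0 , β≈0) =
    resp allMinorsZero-invariant (≋-sym σ≋γe₃e₃) (minorsZero-scale γ _ (outer-minorsZero (vec3 0# 0# 1#)))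
    where
    γ·0 : ∀ y → γ * (y * 0#) ≈ 0#
    γ·0 y = trans (*-congˡ (zeroʳ y)) (zeroʳ γ)
    γ0· : ∀ y → γ * (0# * y) ≈ 0#
    γ0· y = trans (*-congˡ (zeroˡ y)) (zeroʳ γ)
    σ≋γe₃e₃ : σ α β γ ≋ scale γ (outer (vec3 0# 0# 1#))
    σ≋γe₃e₃ zero zero = trans α≈0 (sym (γ·0 0#))
    σ≋γe₃e₃ zero (suc zero) = trans β≈0 (sym (γ·0 0#))
    σ≋γe₃e₃ zero (suc (suc zero)) = sym (γ0· 1#)
    σ≋γe₃e₃ (suc zero) zero = trans β≈0 (sym (γ·0 0#))
    σ≋γe₃e₃ (suc zero) (suc zero) = trans (trans (*-congˡ α≈0) (zeroʳ ε)) (sym (γ·0 0#))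
    σ≋γe₃e₃ (suc zero) (suc (suc zero)) = sym (γ0· 1#)
    σ≋γe₃e₃ (suc (suc zero)) zero = sym (γ·0 1#)
    σ≋γe₃e₃ (suc (suc zero)) (suc zero) = sym (γ·0 1#)
    σ≋γe₃e₃ (suc (suc zero)) (suc (suc zero)) = sym (trans (*-congˡ (*-identityˡ 1#)) (*-identityʳ γ))

  rank1-σ : ∀ {α β γ} → Rank1 (σ α β γ) → BothZero α β × NZ γ
  rank1-σ {α} {β} (nonzero , minorsZero) = α,β≈0 , λ γ≈0 → nonzero (allZero α,β≈0 γ≈0)
    where
    α,β≈0 = D-anisotropic (minorsZero f0 f1 f0 f1)
    allZero : BothZero α β → ∀ {γ} → γ ≈ 0# → AllZero (σ α β γ)
    allZero (α≈0 , β≈0) γ≈0 zero zero = α≈0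
    allZero (α≈0 , β≈0) γ≈0 zero (suc zero) = β≈0
    allZero (α≈0 , β≈0) γ≈0 zero (suc (suc zero)) = refl
    allZero (α≈0 , β≈0) γ≈0 (suc zero) zero = β≈0
    allZero (α≈0 , β≈0) γ≈0 (suc zero) (suc zero) = trans (*-congˡ α≈0) (zeroʳ ε)
    allZero (α≈0 , β≈0) γ≈0 (suc zero) (suc (suc zero)) = refl
    allZero (α≈0 , β≈0) γ≈0 (suc (suc zero)) zero = refl
    allZero (α≈0 , β≈0) γ≈0 (suc (suc zero)) (suc zero) = refl
    allZero (α≈0 , β≈0) γ≈0 (suc (suc zero)) (suc (suc zero)) = γ≈0

  σ001-rank1 : Rank1 (σ 0# 0# 1#)
  σ001-rank1 = (λ allZero → 1≉0 (allZero f2 f2)) , σ-minorsZero 1# (refl , refl)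

  rank2-σ : ∀ {α β γ} → Rank2 (σ α β γ) → γ ≈ 0# × NotBothZero α β
  rank2-σ {α} {β} {γ} (notMinorsZero , det≈0) = γ≈0 , nbz
    where
    nbz : NotBothZero α β
    nbz bz = notMinorsZero (σ-minorsZero γ bz)
    γ≈0 : γ ≈ 0#
    γ≈0 with zero-product (trans (sym (det-σ α β γ)) det≈0)
    ... | inj₁ γ≈0 = γ≈0
    ... | inj₂ D≈0 = ⊥-elim (D≉0 nbz D≈0)

  σ-rank2 : ∀ {α β} → NotBothZero α β → Rank2 (σ α β 0#)
  σ-rank2 {α} {β} nbz = (λ minorsZero → D≉0 nbz (minorsZero f0 f1 f0 f1)) , trans (det-σ α β 0#) (zeroˡ _)

  rank3-σ : ∀ {α β γ} → Rank3 (σ α β γ) → NZ γ × NotBothZero α β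
  rank3-σ {α} {β} {γ} r3 = (λ γ≈0 → r3 (trans (det-σ α β γ) (trans (*-congʳ γ≈0) (zeroˡ _))))
                         , (λ bz → r3 (trans (det-σ α β γ) (D-zero bz)))
    where
    D-zero : BothZero α β → γ * D α β ≈ 0#
    D-zero (α≈0 , β≈0) = trans (*-congˡ (trans (+-cong (*-cong α≈0 (*-congˡ α≈0)) (-‿cong (*-cong β≈0 β≈0)))
      (solve 1 (λ e → con (+ 0) :* (e :* con (+ 0)) :- con (+ 0) :* con (+ 0) := con (+ 0)) refl ε))) (zeroʳ γ)

  σ-rank3 : ∀ {α β γ} → NZ γ → NotBothZero α β → Rank3 (σ α β γ)
  σ-rank3 {α} {β} {γ} γ≉0 nbz det≈0 = mulNZ γ≉0 (D≉0 nbz) (trans (sym (det-σ α β γ)) det≈0)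

  σ-proportional : ∀ {α β γ α' β' γ'} c → NZ c → α ≈ c * α' → β ≈ c * β' → γ ≈ c * γ' →
                   Proportional (σ α β γ) (σ α' β' γ')
  σ-proportional {α} {β} {γ} {α'} {β'} {γ'} c c≉0 eα eβ eγ = c , c≉0 , σ≋
    where
    σ≋ : σ α β γ ≋ scale c (σ α' β' γ')
    σ≋ zero zero = eα
    σ≋ zero (suc zero) = eβ
    σ≋ zero (suc (suc zero)) = sym (zeroʳ c)
    σ≋ (suc zero) zero = eβ
    σ≋ (suc zero) (suc zero) = trans (*-congˡ eα) (solve 3 (λ e c a → e :* (c :* a) := c :* (e :* a)) refl ε c α')
    σ≋ (suc zero) (suc (suc zero)) = sym (zeroʳ c)
    σ≋ (suc (suc zero)) zero = sym (zeroʳ c)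
    σ≋ (suc (suc zero)) (suc zero) = sym (zeroʳ c)
    σ≋ (suc (suc zero)) (suc (suc zero)) = eγ

  proportional-σ : ∀ {α β γ α' β' γ'} → Proportional (σ α β γ) (σ α' β' γ') →
                   Σ Carrier λ c → NZ c × α ≈ c * α' × β ≈ c * β' × γ ≈ c * γ'
  proportional-σ (c , c≉0 , e) = c , c≉0 , e f0 f0 , e f0 f1 , e f2 f2


-- For the rank-2 point σ(α,β,0)
-- the conic points are x xᵀ with x = (x₁,x₂,0) ≠ 0, and on the line through
-- σ(α,β,0) and x xᵀ the leading 2×2 minor is D(α,β) + t·Q(x), where
--   Q_{α,β}(x₁,x₂) = εα x₁² + α x₂² − 2β x₁x₂.
-- Hence the line is tangent iff Q(x) = 0, and σ(α,β,0) is exterior iff the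
-- binary form Q_{α,β} is isotropic.
module ExteriorCriterion (F : FiniteField) (ε : FiniteField.Carrier F)
       (nonsquare : ¬ (Σ (FiniteField.Carrier F) λ x → FiniteField._≈_ F (FiniteField._*_ F x x) ε)) where
  open FieldFacts F
  open Invariance F
  open StandardPlane F ε nonsquare

  Q : Carrier → Carrier → Carrier → Carrier → Carrier
  Q α β x₁ x₂ = (ε * α) * (x₁ * x₁) + α * (x₂ * x₂) - (β + β) * (x₁ * x₂)

  Isotropic : Carrier → Carrier → Set
  Isotropic α β = Σ Carrier λ x₁ → Σ Carrier λ x₂ → NotBothZero x₁ x₂ × Q α β x₁ x₂ ≈ 0#

  pencil-minor : ∀ α β t x₁ x₂ →
    (α + t * (x₁ * x₁)) * (ε * α + t * (x₂ * x₂)) - (β + t * (x₁ * x₂)) * (β + t * (x₁ * x₂))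
    ≈ D α β + t * Q α β x₁ x₂
  pencil-minor α β t x₁ x₂ = solve 6 (λ a b e t y₁ y₂ →
      (a :+ t :* (y₁ :* y₁)) :* ((e :* a) :+ t :* (y₂ :* y₂)) :- (b :+ t :* (y₁ :* y₂)) :* (b :+ t :* (y₁ :* y₂))
      := (a :* (e :* a) :- b :* b) :+ t :* ((e :* a) :* (y₁ :* y₁) :+ a :* (y₂ :* y₂) :- (b :+ b) :* (y₁ :* y₂))) refl
    α β ε t x₁ x₂

  block : Carrier → Carrier → Carrier → Mat
  block a b c zero zero = a
  block a b c zero (suc zero) = b
  block a b c (suc zero) zero = b
  block a b c (suc zero) (suc zero) = c
  block a b c _ _ = 0#

  -- a singular block has rank ≤ 1: it is c e₂e₂ᵀ if a = 0, else a⁻¹ v vᵀ for v = (a,b,0)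
  singular-block : ∀ a b c → a * c - b * b ≈ 0# → AllMinorsZero (block a b c)
  singular-block a b c singular with a ≟ 0#
  ... | yes a≈0 = resp allMinorsZero-invariant (≋-sym block≋) (minorsZero-scale c _ (outer-minorsZero (vec3 0# 1# 0#)))
    where
    b≈0 : b ≈ 0#
    b≈0 = square-zero (sym (diff-zero (trans (sym (+-congʳ (trans (*-congʳ a≈0) (zeroˡ c)))) singular)))
    c·0 : ∀ y → c * (y * 0#) ≈ 0#
    c·0 y = trans (*-congˡ (zeroʳ y)) (zeroʳ c)
    c0· : ∀ y → c * (0# * y) ≈ 0#
    c0· y = trans (*-congˡ (zeroˡ y)) (zeroʳ c)
    block≋ : block a b c ≋ scale c (outer (vec3 0# 1# 0#))
    block≋ zero zero = trans a≈0 (sym (c·0 0#))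
    block≋ zero (suc zero) = trans b≈0 (sym (c0· 1#))
    block≋ zero (suc (suc zero)) = sym (c·0 0#)
    block≋ (suc zero) zero = trans b≈0 (sym (c·0 1#))
    block≋ (suc zero) (suc zero) = sym (trans (*-congˡ (*-identityˡ 1#)) (*-identityʳ c))
    block≋ (suc zero) (suc (suc zero)) = sym (c·0 1#)
    block≋ (suc (suc zero)) zero = sym (c·0 0#)
    block≋ (suc (suc zero)) (suc zero) = sym (c0· 1#)
    block≋ (suc (suc zero)) (suc (suc zero)) = sym (c·0 0#)
  ... | no a≉0 = resp allMinorsZero-invariant (≋-sym block≋) (minorsZero-scale ia _ (outer-minorsZero (vec3 a b 0#)))
    where
    ia = inv a a≉0
    ia·0 : ∀ y → ia * (y * 0#) ≈ 0#
    ia·0 y = trans (*-congˡ (zeroʳ y)) (zeroʳ ia)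
    ia0· : ∀ y → ia * (0# * y) ≈ 0#
    ia0· y = trans (*-congˡ (zeroˡ y)) (zeroʳ ia)
    unscale : ∀ y → y ≈ ia * (a * y)
    unscale y = solve-for a a≉0 refl
    block≋ : block a b c ≋ scale ia (outer (vec3 a b 0#))
    block≋ zero zero = unscale a
    block≋ zero (suc zero) = unscale b
    block≋ zero (suc (suc zero)) = sym (ia·0 a)
    block≋ (suc zero) zero = trans (unscale b) (*-congˡ (*-comm a b))
    block≋ (suc zero) (suc zero) = trans (unscale c) (*-congˡ (diff-zero singular))
    block≋ (suc zero) (suc (suc zero)) = sym (ia·0 b)
    block≋ (suc (suc zero)) zero = sym (ia0· a)
    block≋ (suc (suc zero)) (suc zero) = sym (ia0· b)
    block≋ (suc (suc zero)) (suc (suc zero)) = sym (ia·0 0#)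

  isotropic⇒exterior : ∀ {α β} → NotBothZero α β → Isotropic α β → Exterior (σ α β 0#)
  isotropic⇒exterior {α} {β} nbz (x₁ , x₂ , x≠0 , Q≈0) =
    σ-rank2 nbz , x , (x≠0' , w , onConic) , tangent
    where
    x = vec3 x₁ x₂ 0#
    x≠0' : NonzeroVec x
    x≠0' z = x≠0 (z f0 , z f1)
    iD = inv (D α β) (D≉0 nbz)
    -- σ(α,β,0) w = x for w = D⁻¹ (εα x₁ − β x₂, α x₂ − β x₁, 0)
    w = vec3 (iD * ((ε * α) * x₁ - β * x₂)) (iD * (α * x₂ - β * x₁)) 0#
    unit : ∀ y → (iD * D α β) * y ≈ y
    unit y = trans (*-congʳ (inv-l (D α β) (D≉0 nbz))) (*-identityˡ y)
    onConic : ∀ i → x i ≈ sum3 (λ k → σ α β 0# i k * w k)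
    onConic zero = sym (trans (solve 6 (λ a b e i y₁ y₂ →
        a :* (i :* ((e :* a) :* y₁ :- b :* y₂)) :+ (b :* (i :* (a :* y₂ :- b :* y₁)) :+ con (+ 0) :* con (+ 0))
        := (i :* (a :* (e :* a) :- b :* b)) :* y₁) refl α β ε iD x₁ x₂) (unit x₁))
    onConic (suc zero) = sym (trans (solve 6 (λ a b e i y₁ y₂ →
        b :* (i :* ((e :* a) :* y₁ :- b :* y₂)) :+ ((e :* a) :* (i :* (a :* y₂ :- b :* y₁)) :+ con (+ 0) :* con (+ 0))
        := (i :* (a :* (e :* a) :- b :* b)) :* y₂) refl α β ε iD x₁ x₂) (unit x₂))
    onConic (suc (suc zero)) = sym (solve 2 (λ u v →
        con (+ 0) :* u :+ (con (+ 0) :* v :+ con (+ 0) :* con (+ 0)) := con (+ 0)) refl (w f0) (w f1))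
    -- along the line the leading minor stays D(α,β) ≠ 0
    tangent : ∀ t → ¬ Rank1 (σ α β 0# +M scale t (outer x))
    tangent t (_ , minorsZero) = D≉0 nbz (begin
      D α β                         ≈⟨ sym (trans (+-congˡ (trans (*-congˡ Q≈0) (zeroʳ t))) (+-identityʳ _)) ⟩
      D α β + t * Q α β x₁ x₂       ≈⟨ sym (pencil-minor α β t x₁ x₂) ⟩
      _                             ≈⟨ +-congˡ (-‿cong (*-congˡ (+-congˡ (*-congˡ (*-comm x₁ x₂))))) ⟩
      minor (σ α β 0# +M scale t (outer x)) f0 f1 f0 f1   ≈⟨ minorsZero f0 f1 f0 f1 ⟩
      0#                            ∎)
      where open ≈-Reasoning

  conic-in-block : ∀ {α β γ x} → Rank2 (σ α β γ) → OnConicOf (σ α β γ) x → x f2 ≈ 0#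
  conic-in-block {α} {β} {γ} {x} r2 (_ , w , onConic) =
    trans (onConic f2) (trans (+-congˡ (+-congˡ (*-congʳ (proj₁ (rank2-σ r2)))))
      (solve 3 (λ a b c → con (+ 0) :* a :+ (con (+ 0) :* b :+ con (+ 0) :* c) := con (+ 0)) refl (w f0) (w f1) (w f2)))

  -- conversely, on a tangent line Q(x) = 0: otherwise the pencil point with
  -- t = −D/Q(x) is singular and nonzero, i.e. a second rank-1 point
  exterior⇒isotropic : ∀ {α β γ} → Exterior (σ α β γ) → Isotropic α β
  exterior⇒isotropic {α} {β} {γ} (r2 , x , onConic , tangent) with Q α β (x f0) (x f1) ≟ 0#
  ... | yes Q≈0 = x f0 , x f1 , x₁,₂≠0 , Q≈0
    where
    x₁,₂≠0 : NotBothZero (x f0) (x f1)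
    x₁,₂≠0 (x₁≈0 , x₂≈0) = proj₁ onConic λ { zero → x₁≈0 ; (suc zero) → x₂≈0 ; (suc (suc zero)) → conic-in-block r2 onConic }
  ... | no Q≉0 = ⊥-elim (tangent t (nonzero , resp allMinorsZero-invariant (≋-sym pencil≋block) (singular-block a b c singular)))
    where
    γ≈0 = proj₁ (rank2-σ r2)
    x₁ = x f0
    x₂ = x f1
    x₃≈0 = conic-in-block r2 onConic
    iQ = inv (Q α β x₁ x₂) Q≉0
    t = - (D α β * iQ)
    a = α + t * (x₁ * x₁)
    b = β + t * (x₁ * x₂)
    c = ε * α + t * (x₂ * x₂)
    pencil = σ α β γ +M scale t (outer x)
    kill : ∀ {g} y z → g ≈ 0# → z ≈ 0# → g + t * (y * z) ≈ 0#
    kill y z g≈0 z≈0 = trans (+-cong g≈0 (trans (*-congˡ (trans (*-congˡ z≈0) (zeroʳ y))) (zeroʳ t))) (+-identityˡ 0#)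
    kill' : ∀ {g} y z → g ≈ 0# → y ≈ 0# → g + t * (y * z) ≈ 0#
    kill' y z g≈0 y≈0 = trans (+-congˡ (*-congˡ (*-comm y z))) (kill z y g≈0 y≈0)
    pencil≋block : pencil ≋ block a b c
    pencil≋block zero zero = refl
    pencil≋block zero (suc zero) = refl
    pencil≋block zero (suc (suc zero)) = kill x₁ (x f2) refl x₃≈0
    pencil≋block (suc zero) zero = +-congˡ (*-congˡ (*-comm x₂ x₁))
    pencil≋block (suc zero) (suc zero) = refl
    pencil≋block (suc zero) (suc (suc zero)) = kill x₂ (x f2) refl x₃≈0
    pencil≋block (suc (suc zero)) zero = kill' (x f2) x₁ refl x₃≈0
    pencil≋block (suc (suc zero)) (suc zero) = kill' (x f2) x₂ refl x₃≈0
    pencil≋block (suc (suc zero)) (suc (suc zero)) = kill (x f2) (x f2) γ≈0 x₃≈0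
    singular : a * c - b * b ≈ 0#
    singular = begin
      a * c - b * b                       ≈⟨ pencil-minor α β t x₁ x₂ ⟩
      D α β + t * Q α β x₁ x₂             ≈⟨ solve 3 (λ d i q → d :+ (:- (d :* i)) :* q := d :- d :* (i :* q)) refl (D α β) iQ _ ⟩
      D α β - D α β * (iQ * Q α β x₁ x₂)  ≈⟨ +-congˡ (-‿cong (trans (*-congˡ (inv-l _ Q≉0)) (*-identityʳ _))) ⟩
      D α β - D α β                       ≈⟨ -‿inverseʳ (D α β) ⟩
      0#                                  ∎
      where open ≈-Reasoning
    -- a, b, c cannot all vanish, since D(α,β) is a combination of them
    nonzero : ¬ AllZero pencil
    nonzero allZero = D≉0 (proj₂ (rank2-σ r2)) (trans combination (sum-of-zeros (entry f0 f0) (entry f0 f1) (entry f1 f1)))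
      where
      entry : ∀ i j → block a b c i j ≈ 0#
      entry i j = trans (sym (pencil≋block i j)) (allZero i j)
      combination : D α β ≈ (c - t * (x₂ * x₂)) * a + ((- b + t * (x₁ * x₂ + x₁ * x₂)) * b + (- (t * (x₁ * x₁))) * c)
      combination = solve 6 (λ a b e t y₁ y₂ →
          a :* (e :* a) :- b :* b
          := (((e :* a) :+ t :* (y₂ :* y₂)) :- t :* (y₂ :* y₂)) :* (a :+ t :* (y₁ :* y₁))
             :+ ((:- (b :+ t :* (y₁ :* y₂)) :+ t :* ((y₁ :* y₂) :+ (y₁ :* y₂))) :* (b :+ t :* (y₁ :* y₂))
             :+ (:- (t :* (y₁ :* y₁))) :* ((e :* a) :+ t :* (y₂ :* y₂)))) refl α β ε t x₁ x₂


-- With ν(x₁,x₂) = (2x₁x₂, εx₁² + x₂²)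
-- one has Q_s(x) = s₁ν(x)₂ − s₂ν(x)₁, so x is isotropic for Q_s exactly when
-- s ∼ ν(x) in the projective line.  The map ν is 2-to-1 on the projective
-- line: its fibres are the pairs {x, x*} with x* = (x₂, εx₁), and x ≁ x*.
module QuadraticMap (F : FiniteField) (ε : FiniteField.Carrier F)
       (nonsquare : ¬ (Σ (FiniteField.Carrier F) λ x → FiniteField._≈_ F (FiniteField._*_ F x x) ε)) where
  open FieldFacts F
  open StandardPlane F ε nonsquare
  open ExteriorCriterion F ε nonsquare

  Pair : Set
  Pair = Carrier × Carrier

  Nonzero : Pair → Set
  Nonzero (a , b) = NotBothZero a b

  -- proportionality of pairs (equality as points of the projective line)
  _∼_ : Pair → Pair → Set
  (a , b) ∼ (a' , b') = Σ Carrier λ c → NZ c × a ≈ c * a' × b ≈ c * b'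

  ∼-sym : ∀ {u v} → u ∼ v → v ∼ u
  ∼-sym (c , c≉0 , e₁ , e₂) = inv c c≉0 , inv-nz c c≉0 , solve-for c c≉0 e₁ , solve-for c c≉0 e₂

  ∼-trans : ∀ {u v w} → u ∼ v → v ∼ w → u ∼ w
  ∼-trans (c , c≉0 , e₁ , e₂) (d , d≉0 , f₁ , f₂) =
    c * d , mulNZ c≉0 d≉0 , trans e₁ (trans (*-congˡ f₁) (sym (*-assoc _ _ _))) , trans e₂ (trans (*-congˡ f₂) (sym (*-assoc _ _ _)))

  ∼-euclidean : ∀ {u v w} → u ∼ w → v ∼ w → u ∼ v
  ∼-euclidean p q = ∼-trans p (∼-sym q)

  cross-zero⇒∼ : ∀ {u₁ u₂ v₁ v₂} → NotBothZero u₁ u₂ → NotBothZero v₁ v₂ → u₁ * v₂ ≈ u₂ * v₁ → (u₁ , u₂) ∼ (v₁ , v₂)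
  cross-zero⇒∼ {u₁} {u₂} {v₁} {v₂} u≠0 v≠0 cross with v₁ ≟ 0#
  ... | no v₁≉0 = c , c≉0 , e₁ , e₂
    where
    iv = inv v₁ v₁≉0
    c = u₁ * iv
    e₁ : u₁ ≈ c * v₁
    e₁ = sym (trans (*-assoc _ _ _) (trans (*-congˡ (inv-l v₁ v₁≉0)) (*-identityʳ u₁)))
    e₂ : u₂ ≈ c * v₂
    e₂ = sym (begin
      (u₁ * iv) * v₂    ≈⟨ solve 3 (λ a b c → (a :* b) :* c := (a :* c) :* b) refl u₁ iv v₂ ⟩
      (u₁ * v₂) * iv    ≈⟨ *-congʳ cross ⟩
      (u₂ * v₁) * iv    ≈⟨ *-assoc _ _ _ ⟩
      u₂ * (v₁ * iv)    ≈⟨ trans (*-congˡ (inv-r v₁ v₁≉0)) (*-identityʳ u₂) ⟩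
      u₂                ∎)
      where open ≈-Reasoning
    c≉0 : NZ c
    c≉0 c≈0 = u≠0 (u₁≈0 , cancel0 v₁≉0 (trans (*-comm v₁ u₂) (trans (sym cross) (trans (*-congʳ u₁≈0) (zeroˡ v₂)))))
      where
      u₁≈0 : u₁ ≈ 0#
      u₁≈0 = trans e₁ (trans (*-congʳ c≈0) (zeroˡ v₁))
  ... | yes v₁≈0 = c , c≉0 , e₁ , e₂
    where
    v₂≉0 : NZ v₂
    v₂≉0 v₂≈0 = v≠0 (v₁≈0 , v₂≈0)
    c = u₂ * inv v₂ v₂≉0
    u₁≈0 : u₁ ≈ 0#
    u₁≈0 = cancel0 v₂≉0 (trans (*-comm v₂ u₁) (trans cross (trans (*-congˡ v₁≈0) (zeroʳ u₂))))
    e₁ : u₁ ≈ c * v₁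
    e₁ = trans u₁≈0 (sym (trans (*-congˡ v₁≈0) (zeroʳ c)))
    e₂ : u₂ ≈ c * v₂
    e₂ = sym (trans (*-assoc _ _ _) (trans (*-congˡ (inv-l v₂ v₂≉0)) (*-identityʳ u₂)))
    c≉0 : NZ c
    c≉0 c≈0 = u≠0 (u₁≈0 , trans e₂ (trans (*-congʳ c≈0) (zeroˡ v₂)))

  two : Carrier
  two = 1# + 1#

  -- the characteristic is odd: if 2 = 0 then x ↦ x² would be injective, hence
  -- onto by finiteness, and ε would be a square
  two≉0 : NZ two
  two≉0 two≈0 = ℕP.<-irrefl (ListP.length-map (λ x → x * x) elems)
    (Counting.card-≤ _≈_ (λ e f → trans e (sym f)) (ε ∷ squares) elems (ε-new elems ∷ squares-distinct) (All.tabulate (λ {a} _ → complete a)))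
    where
    squares = map (λ x → x * x) elems
    -- (x − y)² = x² − y² when 2 = 0
    square-injective : ∀ x y → x * x ≈ y * y → x ≈ y
    square-injective x y e = diff-zero (square-zero (begin
      (x - y) * (x - y)                                  ≈⟨ solve 2 (λ x y → (x :- y) :* (x :- y)
                                                             := (x :* x :- y :* y) :+ (con (+ 2) :* (y :* y) :- con (+ 2) :* (x :* y))) refl x y ⟩
      (x * x - y * y) + (two * (y * y) - two * (x * y))  ≈⟨ +-cong (zero-diff e) (+-cong (*-congʳ two≈0) (-‿cong (*-congʳ two≈0))) ⟩
      0# + (0# * (y * y) - 0# * (x * y))                 ≈⟨ solve 2 (λ a b → con (+ 0) :+ (con (+ 0) :* a :- con (+ 0) :* b) := con (+ 0)) refl (y * y) (x * y) ⟩
      0#                                                 ∎))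
      where open ≈-Reasoning
    ε-new : ∀ xs → All (λ b → ¬ ε ≈ b) (map (λ x → x * x) xs)
    ε-new [] = []
    ε-new (x ∷ xs) = (λ e → nonsquare (x , sym e)) ∷ ε-new xs
    squares-distinct : AllPairs (λ a b → ¬ a ≈ b) squares
    squares-distinct = AllPairsP.map⁺ (AllPairs.map (λ {x} {y} x≉y sq → x≉y (square-injective x y sq)) distinct)

  ν : Pair → Pair
  ν (x₁ , x₂) = x₁ * x₂ + x₁ * x₂ , ε * (x₁ * x₁) + x₂ * x₂

  _* : Pair → Pair
  (x₁ , x₂) * = x₂ , ε * x₁

  Qp : Pair → Pair → Carrier
  Qp (a , b) (x₁ , x₂) = Q a b x₁ x₂

  Q-cong : ∀ {a b a' b' x₁ x₂ y₁ y₂} → a ≈ a' → b ≈ b' → x₁ ≈ y₁ → x₂ ≈ y₂ → Q a b x₁ x₂ ≈ Q a' b' y₁ y₂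
  Q-cong ea eb e₁ e₂ = +-cong (+-cong (*-cong (*-congˡ ea) (*-cong e₁ e₁)) (*-cong ea (*-cong e₂ e₂)))
                              (-‿cong (*-cong (+-cong eb eb) (*-cong e₁ e₂)))

  Q-cross : ∀ s x → Qp s x ≈ proj₁ s * proj₂ (ν x) - proj₂ s * proj₁ (ν x)
  Q-cross (a , b) (x₁ , x₂) = solve 5 (λ e a b y₁ y₂ →
      (e :* a) :* (y₁ :* y₁) :+ a :* (y₂ :* y₂) :- (b :+ b) :* (y₁ :* y₂)
      := a :* (e :* (y₁ :* y₁) :+ y₂ :* y₂) :- b :* ((y₁ :* y₂) :+ (y₁ :* y₂))) refl ε a b x₁ x₂

  Q-swap : ∀ s x → Qp s (x *) ≈ ε * Qp s x
  Q-swap (a , b) (x₁ , x₂) = solve 5 (λ e a b y₁ y₂ →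
      (e :* a) :* (y₂ :* y₂) :+ a :* ((e :* y₁) :* (e :* y₁)) :- (b :+ b) :* (y₂ :* (e :* y₁))
      := e :* ((e :* a) :* (y₁ :* y₁) :+ a :* (y₂ :* y₂) :- (b :+ b) :* (y₁ :* y₂))) refl ε a b x₁ x₂

  Q-scale : ∀ c a b x → Qp (c * a , c * b) x ≈ c * Qp (a , b) x
  Q-scale c a b (x₁ , x₂) = solve 6 (λ e c a b y₁ y₂ →
      (e :* (c :* a)) :* (y₁ :* y₁) :+ (c :* a) :* (y₂ :* y₂) :- ((c :* b) :+ (c :* b)) :* (y₁ :* y₂)
      := c :* ((e :* a) :* (y₁ :* y₁) :+ a :* (y₂ :* y₂) :- (b :+ b) :* (y₁ :* y₂))) refl ε c a b x₁ x₂

  Q-∼ : ∀ {s t} x → s ∼ t → Qp t x ≈ 0# → Qp s x ≈ 0#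
  Q-∼ {_} {a , b} x (c , _ , e₁ , e₂) Q≈0 =
    trans (Q-cong e₁ e₂ refl refl) (trans (Q-scale c a b x) (trans (*-congˡ Q≈0) (zeroʳ c)))

  Q-swap-zero : ∀ s x → Qp s x ≈ 0# → Qp s (x *) ≈ 0#
  Q-swap-zero s x Q≈0 = trans (Q-swap s x) (trans (*-congˡ Q≈0) (zeroʳ ε))

  swap-nonzero : ∀ x → Nonzero x → Nonzero (x *)
  swap-nonzero x x≠0 (x₂≈0 , εx₁≈0) = x≠0 (cancel0 ε≉0 εx₁≈0 , x₂≈0)

  -- ν(x) ≠ 0: 2x₁x₂ = 0 forces x₁ = 0 or x₂ = 0, and then εx₁² + x₂² = 0 forces x = 0
  ν-nonzero : ∀ x → Nonzero x → Nonzero (ν x)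
  ν-nonzero (x₁ , x₂) x≠0 (2x₁x₂≈0 , norm≈0) = [ x₁≉0 , x₂≉0 ]′ (zero-product (cancel0 two≉0 (trans (sym doubled) 2x₁x₂≈0)))
    where
    doubled : x₁ * x₂ + x₁ * x₂ ≈ two * (x₁ * x₂)
    doubled = sym (trans (distribʳ _ 1# 1#) (+-cong (*-identityˡ _) (*-identityˡ _)))
    x₁≉0 : ¬ x₁ ≈ 0#
    x₁≉0 x₁≈0 = x≠0 (x₁≈0 , square-zero (trans (sym (+-identityˡ _))
      (trans (+-congʳ (sym (trans (*-congˡ (trans (*-congʳ x₁≈0) (zeroˡ _))) (zeroʳ ε)))) norm≈0)))
    x₂≉0 : ¬ x₂ ≈ 0#
    x₂≉0 x₂≈0 = x≠0 (square-zero (cancel0 ε≉0 (trans (sym (+-identityʳ _))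
      (trans (+-congˡ (sym (trans (*-congʳ x₂≈0) (zeroˡ _)))) norm≈0))) , x₂≈0)

  isotropic⇒∼ν : ∀ s x → Nonzero s → Nonzero x → Qp s x ≈ 0# → s ∼ ν x
  isotropic⇒∼ν s x s≠0 x≠0 Q≈0 = cross-zero⇒∼ s≠0 (ν-nonzero x x≠0) (diff-zero (trans (sym (Q-cross s x)) Q≈0))

  ν-isotropic : ∀ x → Qp (ν x) x ≈ 0#
  ν-isotropic x = trans (Q-cross (ν x) x) (zero-diff (*-comm _ _))

  ν-∼ : ∀ {x y} → x ∼ y → ν x ∼ ν y
  ν-∼ {x₁ , x₂} {y₁ , y₂} (c , c≉0 , e₁ , e₂) = c * c , mulNZ c≉0 c≉0 ,
    trans (+-cong (*-cong e₁ e₂) (*-cong e₁ e₂))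
      (solve 3 (λ c a b → (c :* a) :* (c :* b) :+ (c :* a) :* (c :* b) := (c :* c) :* (a :* b :+ a :* b)) refl c y₁ y₂) ,
    trans (+-cong (*-congˡ (*-cong e₁ e₁)) (*-cong e₂ e₂))
      (solve 4 (λ e c a b → e :* ((c :* a) :* (c :* a)) :+ (c :* b) :* (c :* b) := (c :* c) :* (e :* (a :* a) :+ b :* b)) refl ε c y₁ y₂)

  -- x and x* are different points: x ∼ x* would give ε = c⁻² (or x = 0)
  x≁x* : ∀ x → Nonzero x → ¬ x ∼ (x *)
  x≁x* (x₁ , x₂) x≠0 (c , c≉0 , e₁ , e₂) with x₁ ≟ 0#
  ... | yes x₁≈0 = x≠0 (x₁≈0 , trans e₂ (trans (*-congˡ (trans (*-congˡ x₁≈0) (zeroʳ ε))) (zeroʳ c)))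
  ... | no x₁≉0 = nonsquare (ic , square)
    where
    open ≈-Reasoning
    ic = inv c c≉0
    unit : 1# ≈ (c * c) * ε
    unit = cancel x₁≉0 (trans (*-identityʳ x₁) (trans e₁ (trans (*-congˡ e₂)
             (solve 3 (λ c e x → c :* (c :* (e :* x)) := x :* ((c :* c) :* e)) refl c ε x₁))))
    square : ic * ic ≈ ε
    square = begin
      ic * ic                      ≈⟨ trans (sym (*-identityʳ _)) (*-congˡ unit) ⟩
      (ic * ic) * ((c * c) * ε)    ≈⟨ solve 3 (λ i c e → (i :* i) :* ((c :* c) :* e) := ((i :* c) :* (i :* c)) :* e) refl ic c ε ⟩
      ((ic * c) * (ic * c)) * ε    ≈⟨ *-congʳ (*-cong (inv-l c c≉0) (inv-l c c≉0)) ⟩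
      (1# * 1#) * ε                ≈⟨ trans (*-congʳ (*-identityˡ 1#)) (*-identityˡ ε) ⟩
      ε                            ∎

  -- the fibres of ν: ν(y) ∼ ν(x) forces y ∼ x or y ∼ x*, since the cross
  -- product of ν(y) and ν(x) factors as 2 (y₁x₂ − y₂x₁)(x₂y₂ − εx₁y₁)
  ν-fibre : ∀ x y → Nonzero x → Nonzero y → ν y ∼ ν x → y ∼ x ⊎ y ∼ (x *)
  ν-fibre (x₁ , x₂) (y₁ , y₂) x≠0 y≠0 (c , _ , e₁ , e₂) =
    [ same , swapped ]′ (zero-product (cancel0 two≉0 (trans (sym factored) (zero-diff cross))))
    where
    cross : proj₁ (ν (y₁ , y₂)) * proj₂ (ν (x₁ , x₂)) ≈ proj₂ (ν (y₁ , y₂)) * proj₁ (ν (x₁ , x₂))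
    cross = trans (*-congʳ e₁) (trans (solve 3 (λ c a b → (c :* a) :* b := (c :* b) :* a) refl c _ _) (sym (*-congʳ e₂)))
    factored : proj₁ (ν (y₁ , y₂)) * proj₂ (ν (x₁ , x₂)) - proj₂ (ν (y₁ , y₂)) * proj₁ (ν (x₁ , x₂))
               ≈ two * ((y₁ * x₂ - y₂ * x₁) * (x₂ * y₂ - ε * (x₁ * y₁)))
    factored = solve 5 (λ e x₁ x₂ y₁ y₂ →
      ((y₁ :* y₂) :+ (y₁ :* y₂)) :* (e :* (x₁ :* x₁) :+ x₂ :* x₂) :- (e :* (y₁ :* y₁) :+ y₂ :* y₂) :* ((x₁ :* x₂) :+ (x₁ :* x₂))
      := con (+ 2) :* ((y₁ :* x₂ :- y₂ :* x₁) :* (x₂ :* y₂ :- e :* (x₁ :* y₁)))) refl ε x₁ x₂ y₁ y₂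
    same : y₁ * x₂ - y₂ * x₁ ≈ 0# → (y₁ , y₂) ∼ (x₁ , x₂) ⊎ (y₁ , y₂) ∼ (x₂ , ε * x₁)
    same d≈0 = inj₁ (cross-zero⇒∼ y≠0 x≠0 (diff-zero d≈0))
    swapped : x₂ * y₂ - ε * (x₁ * y₁) ≈ 0# → (y₁ , y₂) ∼ (x₁ , x₂) ⊎ (y₁ , y₂) ∼ (x₂ , ε * x₁)
    swapped d≈0 = inj₂ (cross-zero⇒∼ y≠0 (swap-nonzero (x₁ , x₂) x≠0)
      (trans (solve 3 (λ a b c → a :* (b :* c) := b :* (c :* a)) refl y₁ ε x₁) (trans (sym (diff-zero d≈0)) (*-comm x₂ y₂))))


-- Counting exterior and interior points of the standard plane: as points of
-- the projective line, the pairs (α,β) with Q_{α,β} isotropic are exactly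
-- half of the q + 1 points.  Indeed their isotropic vectors x, x* (one pair
-- for each) enumerate the whole projective line, since every nonzero y is an
-- isotropic vector of Q_{ν(y)}.
module ProjectiveLineCount (F : FiniteField) (ε : FiniteField.Carrier F)
       (nonsquare : ¬ (Σ (FiniteField.Carrier F) λ x → FiniteField._≈_ F (FiniteField._*_ F x x) ε)) where
  open FieldFacts F
  open ExteriorCriterion F ε nonsquare
  open QuadraticMap F ε nonsquare
  open Counting _∼_

  -- the points (0:1) and (1:b) of the projective line
  line : List Pair
  line = (0# , 1#) ∷ map (1# ,_) elems

  length-line : length line ≡ suc order
  length-line = ≡.cong ℕ.suc (ListP.length-map (1# ,_) elems)

  line-nonzero : All Nonzero line
  line-nonzero = (λ z → 1≉0 (proj₂ z)) ∷ AllP.map⁺ (All.tabulate (λ _ z → 1≉0 (proj₁ z)))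

  line-distinct : Distinct line
  line-distinct = AllP.map⁺ (All.tabulate (λ _ (c , _ , 0≈c1 , 1≈cb) → 1≉0 (trans 1≈cb (trans (*-congʳ (factor 0≈c1)) (zeroˡ _)))))
                ∷ AllPairsP.map⁺ (AllPairs.map (λ {b} {b'} b≉b' (c , _ , 1≈c1 , b≈cb') → b≉b' (trans b≈cb' (trans (*-congʳ (factor 1≈c1)) (*-identityˡ b')))) distinct)
    where
    factor : ∀ {c x} → x ≈ c * 1# → c ≈ x
    factor e = sym (trans e (*-identityʳ _))

  line-complete : ∀ u → Nonzero u → Any (u ∼_) line
  line-complete (a , b) u≠0 with a ≟ 0#
  ... | yes a≈0 = here (b , (λ b≈0 → u≠0 (a≈0 , b≈0)) , trans a≈0 (sym (zeroʳ b)) , sym (*-identityʳ b))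
  ... | no a≉0 = there (AnyP.map⁺ (Any.map (λ {e} b/a≈e → a , a≉0 , sym (*-identityʳ a) , scaled b/a≈e) (complete (b * inv a a≉0))))
    where
    scaled : ∀ {e} → b * inv a a≉0 ≈ e → b ≈ a * e
    scaled b/a≈e = sym (trans (*-congˡ (sym b/a≈e))
      (trans (*-comm a _) (trans (*-assoc _ _ _) (trans (*-congˡ (inv-l a a≉0)) (*-identityʳ b)))))

  IsotropicPt : Pair → Set
  IsotropicPt (a , b) = Isotropic a b

  isotropic? : ∀ s → Dec (IsotropicPt s)
  isotropic? (a , b) = search resp₁ (λ x₁ → search (resp₂ x₁) (λ x₂ → notBothZero? x₁ x₂ ×-dec (Q a b x₁ x₂ ≟ 0#)))
    where
    resp₂ : ∀ x₁ {x₂ y₂} → x₂ ≈ y₂ → NotBothZero x₁ x₂ × Q a b x₁ x₂ ≈ 0# → NotBothZero x₁ y₂ × Q a b x₁ y₂ ≈ 0#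
    resp₂ x₁ e (nbz , Q≈0) = (λ (x₁≈0 , y₂≈0) → nbz (x₁≈0 , trans e y₂≈0)) , trans (Q-cong refl refl refl (sym e)) Q≈0
    resp₁ : ∀ {x₁ y₁} → x₁ ≈ y₁ → Σ Carrier (λ x₂ → NotBothZero x₁ x₂ × Q a b x₁ x₂ ≈ 0#) →
            Σ Carrier (λ x₂ → NotBothZero y₁ x₂ × Q a b y₁ x₂ ≈ 0#)
    resp₁ e (x₂ , nbz , Q≈0) = x₂ , (λ (y₁≈0 , x₂≈0) → nbz (trans e y₁≈0 , x₂≈0)) , trans (Q-cong refl refl (sym e) refl) Q≈0

  exteriorPts interiorPts : List Pair
  exteriorPts = filter isotropic? line
  interiorPts = filter (∁? isotropic?) line

  root : ∀ {s} → IsotropicPt s → Pair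
  root (x₁ , x₂ , _) = x₁ , x₂

  roots : ∀ {L} → All IsotropicPt L → List Pair
  roots [] = []
  roots (i ∷ is) = root i ∷ root i * ∷ roots is

  length-roots : ∀ {L} (is : All IsotropicPt L) → length (roots is) ≡ length L ℕ.+ length L
  length-roots [] = ≡.refl
  length-roots {_ ∷ L} (_ ∷ is) = ≡.cong ℕ.suc (≡.trans (≡.cong ℕ.suc (length-roots is)) (≡.sym (ℕP.+-suc (length L) (length L))))

  roots-nonzero : ∀ {L} (is : All IsotropicPt L) → All Nonzero (roots is)
  roots-nonzero [] = []
  roots-nonzero ((x₁ , x₂ , x≠0 , _) ∷ is) = x≠0 ∷ swap-nonzero (x₁ , x₂) x≠0 ∷ roots-nonzero is

  -- isotropic vectors of inequivalent forms are inequivalent (they have inequivalent ν-images)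
  separated : ∀ {s s' x y} → Nonzero s → Nonzero x → Qp s x ≈ 0# → Nonzero s' → Nonzero y → Qp s' y ≈ 0# → ¬ s ∼ s' → ¬ x ∼ y
  separated {s} {s'} {x} {y} s≠0 x≠0 Qx s'≠0 y≠0 Qy s≁s' x∼y =
    s≁s' (∼-trans (isotropic⇒∼ν s x s≠0 x≠0 Qx) (∼-trans (ν-∼ x∼y) (∼-sym (isotropic⇒∼ν s' y s'≠0 y≠0 Qy))))

  roots-separated : ∀ {L} (is : All IsotropicPt L) → All Nonzero L → ∀ {s x} → Nonzero s → Nonzero x → Qp s x ≈ 0# →
                    All (λ s' → ¬ s ∼ s') L → All (λ y → ¬ x ∼ y) (roots is)
  roots-separated [] [] _ _ _ [] = []
  roots-separated ((x₁ , x₂ , y≠0 , Qy) ∷ is) (s'≠0 ∷ L≠0) s≠0 x≠0 Qx (s≁s' ∷ s≁L) =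
      separated s≠0 x≠0 Qx s'≠0 y≠0 Qy s≁s'
    ∷ separated s≠0 x≠0 Qx s'≠0 (swap-nonzero _ y≠0) (Q-swap-zero _ (x₁ , x₂) Qy) s≁s'
    ∷ roots-separated is L≠0 s≠0 x≠0 Qx s≁L

  roots-distinct : ∀ {L} (is : All IsotropicPt L) → All Nonzero L → Distinct L → Distinct (roots is)
  roots-distinct [] [] [] = []
  roots-distinct ((x₁ , x₂ , x≠0 , Qx) ∷ is) (s≠0 ∷ L≠0) (s≁L ∷ distinct) =
      (x≁x* (x₁ , x₂) x≠0 ∷ roots-separated is L≠0 s≠0 x≠0 Qx s≁L)
    ∷ roots-separated is L≠0 s≠0 (swap-nonzero _ x≠0) (Q-swap-zero _ (x₁ , x₂) Qx) s≁L
    ∷ roots-distinct is L≠0 distinct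

  roots-cover : ∀ {L} (is : All IsotropicPt L) → All Nonzero L → ∀ y → Nonzero y →
                Any (λ s → Qp s y ≈ 0#) L → Any (y ∼_) (roots is)
  roots-cover ((x₁ , x₂ , x≠0 , Qx) ∷ is) (s≠0 ∷ _) y y≠0 (here Qy) =
    [ here , (λ y∼x* → there (here y∼x*)) ]′
      (ν-fibre (x₁ , x₂) y x≠0 y≠0 (∼-trans (∼-sym (isotropic⇒∼ν _ y s≠0 y≠0 Qy)) (isotropic⇒∼ν _ (x₁ , x₂) s≠0 x≠0 Qx)))
  roots-cover (_ ∷ is) (_ ∷ L≠0) y y≠0 (there p) = there (there (roots-cover is L≠0 y y≠0 p))

  exterior-isotropic : All IsotropicPt exteriorPts
  exterior-isotropic = AllP.all-filter isotropic? line

  exterior-nonzero : All Nonzero exteriorPts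
  exterior-nonzero = AllP.filter⁺ isotropic? line-nonzero

  -- every nonzero y is an isotropic vector of the exterior point of the line equivalent to ν(y)
  roots-complete : ∀ y → Nonzero y → Any (y ∼_) (roots exterior-isotropic)
  roots-complete y y≠0 = roots-cover exterior-isotropic exterior-nonzero y y≠0 (any-filter isotropic? onLine)
    where
    onLine : Any (λ s → Qp s y ≈ 0# × IsotropicPt s) line
    onLine = Any.map (λ {s} νy∼s → let Qy = Q-∼ y (∼-sym νy∼s) (ν-isotropic y) in Qy , (proj₁ y , proj₂ y , y≠0 , Qy))
                     (line-complete (ν y) (ν-nonzero y y≠0))

  twice-exterior : length exteriorPts ℕ.+ length exteriorPts ≡ suc order
  twice-exterior = ≡.trans (≡.sym (length-roots exterior-isotropic)) (≡.trans
    (card-≡ ∼-euclidean (roots exterior-isotropic) line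
       (roots-distinct exterior-isotropic exterior-nonzero (AllPairsP.filter⁺ isotropic? line-distinct))
       line-distinct
       (All.map (λ {y} y≠0 → line-complete y y≠0) (roots-nonzero exterior-isotropic))
       (All.map (λ {y} y≠0 → roots-complete y y≠0) line-nonzero))
    length-line)

  half : ∀ m → (m ℕ.+ m) / 2 ≡ m
  half m = ≡.trans (≡.cong (_/ 2) (≡.trans (≡.cong (m ℕ.+_) (≡.sym (ℕP.+-identityʳ m))) (ℕP.*-comm 2 m))) (m*n/n≡m m 2)

  length-exterior : length exteriorPts ≡ (order ℕ.+ 1) / 2
  length-exterior = ≡.sym (≡.trans (≡.cong (_/ 2) (≡.trans (ℕP.+-comm order 1) (≡.sym twice-exterior))) (half _))

  length-interior : length interiorPts ≡ (order ℕ.+ 1) / 2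
  length-interior = ≡.trans (ℕP.+-cancelˡ-≡ (length exteriorPts) _ _
    (≡.trans (≡.trans (length-filter-split isotropic? line) length-line) (≡.sym twice-exterior))) length-exterior

-- The q² − 1 nonzero pairs of field elements, listed up to ≈: together with
-- (0,0) they are represented by the q² pairs of enumerated elements.
module NonzeroPairs (F : FiniteField) where
  open FieldFacts F

  _≐_ : Carrier × Carrier → Carrier × Carrier → Set
  _≐_ = Pointwise _≈_ _≈_

  open Counting _≐_

  allPairs : List (Carrier × Carrier)
  allPairs = cartesianProduct elems elems

  allPairs-complete : ∀ u → Any (u ≐_) allPairs
  allPairs-complete (a , b) = AnyP.cartesianProduct⁺ (complete a) (complete b)

  nonzeroPairs : List (Carrier × Carrier)
  nonzeroPairs = filter (λ (a , b) → notBothZero? a b) allPairs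

  nonzeroPairs-nonzero : All (λ (a , b) → NotBothZero a b) nonzeroPairs
  nonzeroPairs-nonzero = AllP.all-filter _ allPairs

  nonzeroPairs-distinct : Distinct nonzeroPairs
  nonzeroPairs-distinct = AllPairsP.filter⁺ _ (UniqueP.cartesianProduct⁺ setoid setoid distinct distinct)

  nonzeroPairs-complete : ∀ u → NotBothZero (proj₁ u) (proj₂ u) → Any (u ≐_) nonzeroPairs
  nonzeroPairs-complete u u≠0 = any-filter _ (Any.map (λ {v} u≐v → u≐v , λ (a≈0 , b≈0) → u≠0 (trans (proj₁ u≐v) a≈0 , trans (proj₂ u≐v) b≈0)) (allPairs-complete u))

  length-nonzeroPairs : length nonzeroPairs ≡ order ℕ.* order ℕ.∸ 1
  length-nonzeroPairs = ≡.cong (ℕ._∸ 1) (≡.trans (card-≡ ≐-euclidean ((0# , 0#) ∷ nonzeroPairs) allPairs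
      ((All.map (λ u≠0 0≐u → u≠0 (sym (proj₁ 0≐u) , sym (proj₂ 0≐u))) nonzeroPairs-nonzero) ∷ nonzeroPairs-distinct)
      (UniqueP.cartesianProduct⁺ setoid setoid distinct distinct)
      (All.tabulate (λ {u} _ → allPairs-complete u))
      (All.tabulate (λ {u} _ → zero-or-nonzero u)))
    (length-cartesianProduct elems elems))
    where
    ≐-euclidean : ∀ {a b c} → a ≐ c → b ≐ c → a ≐ b
    ≐-euclidean (e₁ , e₂) (f₁ , f₂) = trans e₁ (sym f₁) , trans e₂ (sym f₂)
    zero-or-nonzero : ∀ u → Any (u ≐_) ((0# , 0#) ∷ nonzeroPairs)
    zero-or-nonzero (a , b) with notBothZero? a b
    ... | yes u≠0 = there (nonzeroPairs-complete (a , b) u≠0)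
    ... | no ¬u≠0 with a ≟ 0# | b ≟ 0#
    ...   | yes a≈0 | yes b≈0 = here (a≈0 , b≈0)
    ...   | no a≉0 | _ = ⊥-elim (¬u≠0 (λ bz → a≉0 (proj₁ bz)))
    ...   | yes _ | no b≉0 = ⊥-elim (¬u≠0 (λ bz → b≉0 (proj₂ bz)))


module Sigma6Plane (F : FiniteField) (ε : FiniteField.Carrier F)
       (nonsquare : ¬ (Σ (FiniteField.Carrier F) λ x → FiniteField._≈_ F (FiniteField._*_ F x x) ε))
       (A : Geometry.Mat F) (A-invertible : Geometry.Invertible F A) where
  open FieldFacts F
  open Invariance F
  open StandardPlane F ε nonsquare
  open ExteriorCriterion F ε nonsquare
  open QuadraticMap F ε nonsquare
  open ProjectiveLineCount F ε nonsquare
  open NonzeroPairs F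
  open Counting _∼_ using (Distinct)

  QA : QuasiInverse A
  QA = adjugate-inverse A A-invertible

  Params : Set
  Params = Carrier × Carrier × Carrier

  σ⟨_⟩ : Params → Mat
  σ⟨ α , β , γ ⟩ = σ α β γ

  count-transfer : ∀ {P} → Invariant P → (ps : List Params) → All (λ p → P σ⟨ p ⟩) ps →
    AllPairs (λ p p' → ¬ Proportional σ⟨ p ⟩ σ⟨ p' ⟩) ps →
    (∀ α β γ → P (σ α β γ) → Any (λ p → Proportional (σ α β γ) σ⟨ p ⟩) ps) →
    NumPoints (λ Z → InSigma6Plane ε A Z × P Z) (length ps)
  count-transfer {P} P-invariant ps allP distinct covers = map image ps , ListP.length-map image ps , allImage , distinctImage , completeImage
    where
    image : Params → Mat
    image p = act A σ⟨ p ⟩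
    allImage : All (λ Z → InSigma6Plane ε A Z × P Z) (map image ps)
    allImage = AllP.map⁺ (All.map (λ {p} Pp → (proj₁ p , proj₁ (proj₂ p) , proj₂ (proj₂ p) , ≋-refl) , act⁺ P-invariant QA _ Pp) allP)
    distinctImage : AllPairs (λ M N → ¬ Proportional M N) (map image ps)
    distinctImage = AllPairsP.map⁺ (AllPairs.map (λ p≁p' Mp∼Mp' → p≁p' (proportional-act⁻ QA Mp∼Mp')) distinct)
    completeImage : ∀ Z → InSigma6Plane ε A Z × P Z → Any (Proportional Z) (map image ps)
    completeImage Z ((α , β , γ , Z≋) , PZ) = AnyP.map⁺ (Any.map (λ σ∼p → proportional-resp (≋-sym Z≋) ≋-refl (proportional-act A σ∼p))
                                                        (covers α β γ (act⁻ P-invariant QA _ (resp P-invariant Z≋ PZ))))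

  rank1-count : NumPoints (λ Z → InSigma6Plane ε A Z × Rank1 Z) 1
  rank1-count = count-transfer rank1-invariant ((0# , 0# , 1#) ∷ []) (σ001-rank1 ∷ []) (All.[] AllPairs.∷ AllPairs.[]) covers
    where
    covers : ∀ α β γ → Rank1 (σ α β γ) → Any (λ p → Proportional (σ α β γ) σ⟨ p ⟩) ((0# , 0# , 1#) ∷ [])
    covers α β γ r1 with rank1-σ r1
    ... | (α≈0 , β≈0) , γ≉0 = here (σ-proportional γ γ≉0 (trans α≈0 (sym (zeroʳ γ))) (trans β≈0 (sym (zeroʳ γ))) (sym (*-identityʳ γ)))

  onLine : Pair → Params
  onLine (α , β) = α , β , 0#

  onLine-distinct : ∀ {L} → Distinct L → AllPairs (λ p p' → ¬ Proportional σ⟨ p ⟩ σ⟨ p' ⟩) (map onLine L)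
  onLine-distinct d = AllPairsP.map⁺ (AllPairs.map (λ s≁s' σ∼σ' → let (c , c≉0 , eα , eβ , _) = proportional-σ σ∼σ' in s≁s' (c , c≉0 , eα , eβ)) d)

  onLine-proportional : ∀ {α β γ} → γ ≈ 0# → ∀ s → (α , β) ∼ s → Proportional (σ α β γ) σ⟨ onLine s ⟩
  onLine-proportional γ≈0 s (c , c≉0 , eα , eβ) = σ-proportional c c≉0 eα eβ (trans γ≈0 (sym (zeroʳ c)))

  exterior-count : NumPoints (λ Z → InSigma6Plane ε A Z × Exterior Z) ((order ℕ.+ 1) / 2)
  exterior-count = ≡.subst (NumPoints _) (≡.trans (ListP.length-map onLine exteriorPts) length-exterior)
    (count-transfer exterior-invariant (map onLine exteriorPts) allExterior
      (onLine-distinct (AllPairsP.filter⁺ isotropic? line-distinct)) covers)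
    where
    allExterior : All (λ p → Exterior σ⟨ p ⟩) (map onLine exteriorPts)
    allExterior = AllP.map⁺ (All.zipWith (λ (s≠0 , iso) → isotropic⇒exterior s≠0 iso) (exterior-nonzero , exterior-isotropic))
    covers : ∀ α β γ → Exterior (σ α β γ) → Any (λ p → Proportional (σ α β γ) σ⟨ p ⟩) (map onLine exteriorPts)
    covers α β γ ext@(r2 , _) = AnyP.map⁺ (Any.map (onLine-proportional (proj₁ (rank2-σ r2)) _)
      (any-filter isotropic? (Any.map (λ {s} αβ∼s → αβ∼s , transfer s αβ∼s) (line-complete _ (proj₂ (rank2-σ r2))))))
      where
      transfer : ∀ s → (α , β) ∼ s → IsotropicPt s
      transfer s αβ∼s with exterior⇒isotropic ext
      ... | x₁ , x₂ , x≠0 , Q≈0 = x₁ , x₂ , x≠0 , Q-∼ (x₁ , x₂) (∼-sym αβ∼s) Q≈0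

  interior-count : NumPoints (λ Z → InSigma6Plane ε A Z × Interior Z) ((order ℕ.+ 1) / 2)
  interior-count = ≡.subst (NumPoints _) (≡.trans (ListP.length-map onLine interiorPts) length-interior)
    (count-transfer interior-invariant (map onLine interiorPts) allInterior
      (onLine-distinct (AllPairsP.filter⁺ (∁? isotropic?) line-distinct)) covers)
    where
    allInterior : All (λ p → Interior σ⟨ p ⟩) (map onLine interiorPts)
    allInterior = AllP.map⁺ (All.zipWith (λ (s≠0 , aniso) → σ-rank2 s≠0 , λ ext → aniso (exterior⇒isotropic ext))
                                          (AllP.filter⁺ (∁? isotropic?) line-nonzero , AllP.all-filter (∁? isotropic?) line))
    covers : ∀ α β γ → Interior (σ α β γ) → Any (λ p → Proportional (σ α β γ) σ⟨ p ⟩) (map onLine interiorPts)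
    covers α β γ (r2 , notExterior) = AnyP.map⁺ (Any.map (onLine-proportional γ≈0 _)
      (any-filter (∁? isotropic?) (Any.map (λ {s} αβ∼s → αβ∼s , anisotropic s αβ∼s) (line-complete _ (proj₂ (rank2-σ r2))))))
      where
      γ≈0 = proj₁ (rank2-σ r2)
      -- an isotropic vector for s would make σ(α,β,γ) = σ(α,β,0) exterior
      anisotropic : ∀ s → (α , β) ∼ s → ¬ IsotropicPt s
      anisotropic s αβ∼s (x₁ , x₂ , x≠0 , Q≈0) = notExterior (resp exterior-invariant σ0≋σ
        (isotropic⇒exterior (proj₂ (rank2-σ r2)) (x₁ , x₂ , x≠0 , Q-∼ (x₁ , x₂) αβ∼s Q≈0)))
        where
        σ0≋σ : σ α β 0# ≋ σ α β γ
        σ0≋σ zero zero = refl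
        σ0≋σ zero (suc zero) = refl
        σ0≋σ zero (suc (suc zero)) = refl
        σ0≋σ (suc zero) zero = refl
        σ0≋σ (suc zero) (suc zero) = refl
        σ0≋σ (suc zero) (suc (suc zero)) = refl
        σ0≋σ (suc (suc zero)) zero = refl
        σ0≋σ (suc (suc zero)) (suc zero) = refl
        σ0≋σ (suc (suc zero)) (suc (suc zero)) = sym γ≈0

  rank3-count : NumPoints (λ Z → InSigma6Plane ε A Z × Rank3 Z) (order ℕ.* order ℕ.∸ 1)
  rank3-count = ≡.subst (NumPoints _) (≡.trans (ListP.length-map withγ=1 nonzeroPairs) length-nonzeroPairs)
    (count-transfer rank3-invariant (map withγ=1 nonzeroPairs)
      (AllP.map⁺ (All.map (σ-rank3 1≉0) nonzeroPairs-nonzero))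
      (AllPairsP.map⁺ (AllPairs.map (λ u≭v σu∼σv → u≭v (same-pair σu∼σv)) nonzeroPairs-distinct)) covers)
    where
    withγ=1 : Carrier × Carrier → Params
    withγ=1 (α , β) = α , β , 1#
    -- σ(α,β,1) ∼ σ(α',β',1) forces the factor 1, so (α,β) = (α',β')
    same-pair : ∀ {u v} → Proportional σ⟨ withγ=1 u ⟩ σ⟨ withγ=1 v ⟩ → u ≐ v
    same-pair σu∼σv with proportional-σ σu∼σv
    ... | c , _ , eα , eβ , 1≈c1 = trans eα (c·≈ c≈1) , trans eβ (c·≈ c≈1)
      where
      c≈1 = sym (trans 1≈c1 (*-identityʳ c))
      c·≈ : ∀ {c x} → c ≈ 1# → c * x ≈ x
      c·≈ c≈1 = trans (*-congʳ c≈1) (*-identityˡ _)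
    covers : ∀ α β γ → Rank3 (σ α β γ) → Any (λ p → Proportional (σ α β γ) σ⟨ p ⟩) (map withγ=1 nonzeroPairs)
    covers α β γ r3 = AnyP.map⁺ (Any.map proportional (nonzeroPairs-complete (α * iγ , β * iγ) normalised≠0))
      where
      γ≉0 = proj₁ (rank3-σ r3)
      iγ = inv γ γ≉0
      normalised≠0 : NotBothZero (α * iγ) (β * iγ)
      normalised≠0 (a≈0 , b≈0) = proj₂ (rank3-σ r3)
        (cancel0 (inv-nz γ γ≉0) (trans (*-comm iγ α) a≈0) , cancel0 (inv-nz γ γ≉0) (trans (*-comm iγ β) b≈0))
      unnormalise : ∀ {x y} → x * iγ ≈ y → x ≈ γ * y
      unnormalise {x} e = sym (trans (*-congˡ (sym e)) (trans (*-comm γ _) (trans (*-assoc _ _ _)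
                            (trans (*-congˡ (inv-l γ γ≉0)) (*-identityʳ x)))))
      proportional : ∀ {w} → (α * iγ , β * iγ) ≐ w → Proportional (σ α β γ) σ⟨ withγ=1 w ⟩
      proportional (eα , eβ) = σ-proportional γ γ≉0 (unnormalise eα) (unnormalise eβ) (sym (*-identityʳ γ))

  -- the o₁₀ line with u = 0, v = ε⁻¹: v λ² − 1 = 0 would make ε = λ² a square
  v : Carrier
  v = inv ε ε≉0

  o10-params : O10Params 0# v
  o10-params λ' e = nonsquare (λ' , square)
    where
    vλ²≈1 : v * (λ' * λ') ≈ 1#
    vλ²≈1 = trans (sym (trans (+-congˡ (trans (*-congʳ (zeroˡ v)) (zeroˡ λ'))) (+-identityʳ _))) (diff-zero e)
    square : λ' * λ' ≈ ε
    square = cancel (inv-nz ε ε≉0) (trans vλ²≈1 (sym (inv-l ε ε≉0)))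

  -- a rank-2 point of A Π Aᵀ is A σ(α,β,0) Aᵀ, and σ(α,β,0) is the o₁₀ point with parameters (εα, β)
  rank2-on-o10 : ∀ Z → InSigma6Plane ε A Z → Rank2 Z → InO10Line 0# v A Z
  rank2-on-o10 Z (α , β , γ , Z≋) r2 = ε * α , β , ≋-trans Z≋ (act-cong {A} {A} ≋-refl σ≋o10)
    where
    γ≈0 = proj₁ (rank2-σ (act⁻ rank2-invariant QA _ (resp rank2-invariant Z≋ r2)))
    σ≋o10 : σ α β γ ≋ o10Mat 0# v (ε * α) β
    σ≋o10 zero zero = solve-for ε ε≉0 refl
    σ≋o10 zero (suc zero) = refl
    σ≋o10 zero (suc (suc zero)) = refl
    σ≋o10 (suc zero) zero = refl
    σ≋o10 (suc zero) (suc zero) = sym (trans (+-congˡ (zeroˡ β)) (+-identityʳ _))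
    σ≋o10 (suc zero) (suc (suc zero)) = refl
    σ≋o10 (suc (suc zero)) zero = refl
    σ≋o10 (suc (suc zero)) (suc zero) = refl
    σ≋o10 (suc (suc zero)) (suc (suc zero)) = γ≈0

-- The four point counts and the o₁₀ line come from the analysis of Π carried
-- over by A.
lemma7p1 : (F : FiniteField) →
    let open FiniteField F
        open Geometry F
        q = order
    in ¬ (2 ∣ q) →
       (ε : Carrier) → ¬ (Σ Carrier λ x → x * x ≈ ε) →
       (A : Mat) → Invertible A →
       (NumPoints (λ Z → InSigma6Plane ε A Z × Rank1 Z) 1
        × NumPoints (λ Z → InSigma6Plane ε A Z × Exterior Z) ((q ℕ.+ 1) / 2)
        × NumPoints (λ Z → InSigma6Plane ε A Z × Interior Z) ((q ℕ.+ 1) / 2)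
        × NumPoints (λ Z → InSigma6Plane ε A Z × Rank3 Z) (q ℕ.* q ℕ.∸ 1))
       × (Σ Carrier λ u → Σ Carrier λ v → O10Params u v ×
           (Σ Mat λ B → Invertible B ×
             (∀ Z → InSigma6Plane ε A Z → Rank2 Z → InO10Line u v B Z)))
lemma7p1 F _ ε nonsquare A A-invertible =
  (rank1-count , exterior-count , interior-count , rank3-count) ,
  (0# , v , o10-params , A , A-invertible , rank2-on-o10)
  where
  open FiniteField F using (0#)
  open Sigma6Plane F ε nonsquare A A-invertible
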